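{- For each $m\ge1$, let $c_{3,m}$ be the number of move-equivalence classes of $(3,m)$-amplitrees. Then $$\sum_{m\ge0}c_{3,m+1}x^m=\frac{1+28x+56x^2+14x^3}{(1-x)^7}.$$
   Context: A plabic tree is a plabic graph (planar graph in a disk, black/white internal vertices, boundary vertices $1,\dots,n$ labeled clockwise each incident to one edge, leafless) whose underlying graph is a tree; bipartite with boundary vertices $B_{bd}$ regarded as black and internal black vertices $B_{int}$; its type is $(k,n)$ with $k=1+\sum_{b\in B_{int}}(\deg b-2)$. A $(k,m)$-amplitree is a bipartite plabic tree of type $(k,km+1)$ which is $m$-balanced: for each edge $e$, writing $G\setminus\{e\}=G_1\sqcup G_2$ (each component receiving half of $e$), one has $1\le|B_{bd}\cap G_i|-m\sum_{b\in G_i\cap B_{int}}(\deg b-2)\le m$ for $i=1,2$ (degrees in $G$). Move-equivalence: generated by the plabic graph moves (square move; contracting/expanding adjacent internal vertices of the same color; inserting/removing degree-2 internal vertices). -}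

module Defs where

open import Data.Nat as ℕ using (ℕ; zero; suc; _≤ᵇ_; _∸_)
open import Data.Nat.Combinatorics using (_C_)
open import Data.Integer as ℤ using (ℤ; +_; -_)
open import Data.List using (List; []; _∷_; _++_; length)
open import Data.Product using (_×_; Σ; ∃)
open import Data.Unit using (⊤)
open import Data.Bool using (if_then_else_)
open import Data.Fin using (Fin)
open import Relation.Binary.PropositionalEquality using (_≡_)
open import Relation.Binary.Construct.Closure.Symmetric using (SymClosure)
open import Relation.Binary.Construct.Closure.ReflexiveTransitive using (Star)

-- A plabic tree (up to isotopy fixing the boundary) is encoded as a plane
-- tree rooted at boundary vertex 1: the value T : PT is the subtree hanging
-- off the unique edge at boundary vertex 1.  `bd` is a boundary vertex (a
-- leaf); `int c ts` is an internal vertex of colour c whose remaining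
-- neighbours (other than the one towards boundary vertex 1) are the roots
-- of ts, listed in clockwise order.  The boundary vertices 2,…,n are then
-- the `bd` leaves in depth-first (clockwise) order, so the labelling is
-- forced, and distinct PT values are distinct embedded trees.

data Colour : Set where
  black white : Colour

data PT : Set where
  bd  : PT
  int : Colour → List PT → PT

deg : Colour → List PT → ℕ
deg c ts = suc (length ts)

mutual
  -- leafless: every internal vertex has degree ≥ 2, i.e. at least one child
  WF : PT → Set
  WF bd = ⊤
  WF (int c []) = Data.Empty.⊥
    where import Data.Empty
  WF (int c (t ∷ ts)) = WFL (t ∷ ts)

  WFL : List PT → Set
  WFL [] = ⊤
  WFL (t ∷ ts) = WF t × WFL ts

mutual
  nBd : PT → ℕ
  nBd bd = 1
  nBd (int c ts) = nBdL ts

  nBdL : List PT → ℕ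
  nBdL [] = 0
  nBdL (t ∷ ts) = nBd t ℕ.+ nBdL ts

mutual
  defect : PT → ℤ
  defect bd = + 0
  defect (int black ts) = (+ deg black ts ℤ.- + 2) ℤ.+ defectL ts
  defect (int white ts) = defectL ts

  defectL : List PT → ℤ
  defectL [] = + 0
  defectL (t ∷ ts) = defect t ℤ.+ defectL ts

-- total number of boundary vertices of the plabic tree T (including vertex 1)
nTotal : PT → ℕ
nTotal T = suc (nBd T)

typeK : PT → ℤ
typeK T = + 1 ℤ.+ defect T

flip : Colour → Colour
flip black = white
flip white = black

mutual
  -- bipartite, with boundary vertices regarded as black;
  -- the argument is the colour of the parent vertex
  Bip : Colour → PT → Set
  Bip p bd = p ≡ white
  Bip p (int c ts) = (c ≡ flip p) × BipL c ts

  BipL : Colour → List PT → Set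
  BipL c [] = ⊤
  BipL c (t ∷ ts) = Bip c t × BipL c ts

mutual
  -- P holds for every subtree below an edge (every edge of the tree
  -- is the edge from some vertex to its parent; the root T corresponds
  -- to the edge at boundary vertex 1)
  Every : (PT → Set) → PT → Set
  Every P bd = P bd
  Every P (int c ts) = P (int c ts) × EveryL P ts

  EveryL : (PT → Set) → List PT → Set
  EveryL P [] = ⊤
  EveryL P (t ∷ ts) = Every P t × EveryL P ts

InRange : ℕ → ℤ → Set
InRange m v = (+ 1 ℤ.≤ v) × (v ℤ.≤ + m)

-- m-balanced: removing the edge above subtree S splits T into
-- G₂ = S and G₁ = the rest (containing boundary vertex 1)
Balanced : ℕ → PT → Set
Balanced m T = Every cond T
  where
  cond : PT → Set
  cond S =
    InRange m (+ nBd S ℤ.- + m ℤ.* defect S)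
    × InRange m ((+ nTotal T ℤ.- + nBd S) ℤ.- + m ℤ.* (defect T ℤ.- defect S))

Amplitree : ℕ → ℕ → PT → Set
Amplitree k m T =
  WF T × Bip black T × (typeK T ≡ + k) × (nTotal T ≡ k ℕ.* m ℕ.+ 1)
  × Balanced m T

data Move : PT → PT → Set where
  contract : ∀ c xs y ys zs →
    Move (int c (xs ++ int c (y ∷ ys) ∷ zs)) (int c (xs ++ (y ∷ ys) ++ zs))
  removeDeg2 : ∀ c t → Move (int c (t ∷ [])) t
  inside : ∀ c xs zs {t t'} → Move t t' →
    Move (int c (xs ++ t ∷ zs)) (int c (xs ++ t' ∷ zs))

-- move-equivalence (expansion / insertion are the inverse moves)
_≈ₘ_ : PT → PT → Set
_≈ₘ_ = Star (SymClosure Move)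

record NumClasses (A : PT → Set) (N : ℕ) : Set where
  field
    reps     : Fin N → PT
    repsIn   : ∀ i → A (reps i)
    distinct : ∀ i j → reps i ≈ₘ reps j → i ≡ j
    cover    : ∀ T → A T → ∃ λ i → T ≈ₘ reps i

-- Generating function identity, coefficientwise:
-- (1-x)^7 · Σ_m a m x^m = 1 + 28x + 56x² + 14x³

numerator : ℕ → ℤ
numerator 0 = + 1
numerator 1 = + 28
numerator 2 = + 56
numerator 3 = + 14
numerator _ = + 0

sign : ℕ → ℤ
sign zero = + 1
sign (suc i) = - sign i

-- coefficient of x^m in (1-x)^7 · Σ a_j x^j  =  Σ_{i=0}^{7} (-1)^i C(7,i) a_{m-i}  (a_j = 0 for j<0)
term : (ℕ → ℕ) → ℕ → ℕ → ℤ
term a m i = if i ≤ᵇ m then sign i ℤ.* + (7 C i) ℤ.* + a (m ∸ i) else + 0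

sumTo : ℕ → (ℕ → ℤ) → ℤ
sumTo zero f = f 0
sumTo (suc n) f = sumTo n f ℤ.+ f (suc n)

timesOneMinusX⁷ : (ℕ → ℕ) → ℕ → ℤ
timesOneMinusX⁷ a m = sumTo 7 (term a m)

{-# OPTIONS --safe #-}
module Submission where

-- Moves preserve the number of boundary vertices, the defect Σ (deg b − 2) and the balance
-- of every edge, and a plabic tree is move-equivalent to its normal form nf T (contract the
-- edges between internal vertices of equal colour, suppress internal vertices of degree 2),
-- which is a complete invariant; subdividing the monochromatic edges of a normal tree gives
-- back a bipartite representative. So the classes of (3, M)-amplitrees are the balanced
-- normal trees of defect 2 with 3M boundary leaves. Such a tree is a row of leaves around
-- either one black vertex of degree 4 carrying three fans, or a black vertex of degree 3
-- carrying a fan and a white vertex with a cherry, or two cherries, and balance becomes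
-- linear conditions on the sizes of the fans. Written in the deficits M − 1 − a of the fans,
-- each family is a nested union of products of compositions, counted by nested sums with
-- polynomial closed forms. 720 times the number of classes is a polynomial of degree 6 in
-- M, so its seventh difference vanishes, and the first seven values give the numerator.

open import Defs
open import Data.Nat using (ℕ; suc)
open import Data.Product using (Σ; _×_; _,_)
open import Relation.Binary.PropositionalEquality using (_≡_)

module NormalForms where
  open import Data.List using (List; []; _∷_; _++_; [_])
  open import Data.List.Properties using (++-assoc; ++-identityʳ)
  open import Data.List.Relation.Unary.All as All using (All; []; _∷_)
  open import Data.List.Relation.Unary.All.Properties using (++⁺)
  open import Data.Product using (Σ; _×_; _,_; proj₁; proj₂)
  open import Data.Unit using (⊤; tt)
  open import Data.Empty using (⊥)
  open import Relation.Binary.PropositionalEquality hiding ([_])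
  open import Relation.Binary.Construct.Closure.Symmetric using (fwd)
  open import Relation.Binary.Construct.Closure.ReflexiveTransitive as Star using (Star; ε; _◅_; _◅◅_)
  import Relation.Binary.Construct.Closure.Equivalence as EqClosure

  Unmergeable : Colour → PT → Set
  Unmergeable black (int black (_ ∷ _)) = ⊥
  Unmergeable white (int white (_ ∷ _)) = ⊥
  Unmergeable _ _ = ⊤

  absorb : Colour → PT → List PT
  absorb black (int black (u ∷ us)) = u ∷ us
  absorb white (int white (u ∷ us)) = u ∷ us
  absorb _ t = [ t ]

  collapse : Colour → List PT → PT
  collapse c (u ∷ []) = u
  collapse c us = int c us

  mutual
    nf : PT → PT
    nf bd = bd
    nf (int c ts) = collapse c (nfChildren c ts)

    nfChildren : Colour → List PT → List PT
    nfChildren c [] = []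
    nfChildren c (t ∷ ts) = absorb c (nf t) ++ nfChildren c ts

  NotSingleton : List PT → Set
  NotSingleton (_ ∷ []) = ⊥
  NotSingleton _ = ⊤

  data Normal : PT → Set where
    bd  : Normal bd
    int : ∀ {c us} → NotSingleton us → All (λ u → Unmergeable c u × Normal u) us → Normal (int c us)

  NormalChildren : Colour → List PT → Set
  NormalChildren c = All (λ u → Unmergeable c u × Normal u)

  absorb-normal : ∀ c {t} → Normal t → NormalChildren c (absorb c t)
  absorb-normal black {int black (u ∷ us)} (int _ children) = children
  absorb-normal white {int white (u ∷ us)} (int _ children) = children
  absorb-normal black {bd} n = (tt , n) ∷ []
  absorb-normal white {bd} n = (tt , n) ∷ []
  absorb-normal black {int white _} n = (tt , n) ∷ []
  absorb-normal white {int black _} n = (tt , n) ∷ []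
  absorb-normal black {int black []} n = (tt , n) ∷ []
  absorb-normal white {int white []} n = (tt , n) ∷ []

  collapse-normal : ∀ c {us} → NormalChildren c us → Normal (collapse c us)
  collapse-normal c {[]} _ = int tt []
  collapse-normal c {_ ∷ []} ((_ , n) ∷ []) = n
  collapse-normal c {_ ∷ _ ∷ _} children = int tt children

  mutual
    nf-normal : ∀ t → Normal (nf t)
    nf-normal bd = bd
    nf-normal (int c ts) = collapse-normal c (nfChildren-normal c ts)

    nfChildren-normal : ∀ c ts → NormalChildren c (nfChildren c ts)
    nfChildren-normal c [] = []
    nfChildren-normal c (t ∷ ts) = ++⁺ (absorb-normal c (nf-normal t)) (nfChildren-normal c ts)

  absorb-unmergeable : ∀ c {t} → Unmergeable c t → absorb c t ≡ [ t ]
  absorb-unmergeable black {bd} _ = refl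
  absorb-unmergeable white {bd} _ = refl
  absorb-unmergeable black {int white _} _ = refl
  absorb-unmergeable white {int black _} _ = refl
  absorb-unmergeable black {int black []} _ = refl
  absorb-unmergeable white {int white []} _ = refl

  collapse-notSingleton : ∀ c {us} → NotSingleton us → collapse c us ≡ int c us
  collapse-notSingleton c {[]} _ = refl
  collapse-notSingleton c {_ ∷ _ ∷ _} _ = refl

  mutual
    nf-of-normal : ∀ {t} → Normal t → nf t ≡ t
    nf-of-normal bd = refl
    nf-of-normal {int c us} (int notSingleton children) =
      trans (cong (collapse c) (nfChildren-of-normal children)) (collapse-notSingleton c notSingleton)

    nfChildren-of-normal : ∀ {c us} → NormalChildren c us → nfChildren c us ≡ us
    nfChildren-of-normal [] = refl
    nfChildren-of-normal {c} ((unmergeable , n) ∷ children)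
      rewrite nf-of-normal n | absorb-unmergeable c unmergeable = cong (_ ∷_) (nfChildren-of-normal children)

  nfChildren-++ : ∀ c xs ys → nfChildren c (xs ++ ys) ≡ nfChildren c xs ++ nfChildren c ys
  nfChildren-++ c [] ys = refl
  nfChildren-++ c (x ∷ xs) ys =
    trans (cong (absorb c (nf x) ++_) (nfChildren-++ c xs ys)) (sym (++-assoc (absorb c (nf x)) _ _))

  absorb-collapse : ∀ c u us → All (Unmergeable c) (u ∷ us) → absorb c (collapse c (u ∷ us)) ≡ u ∷ us
  absorb-collapse c u [] (unmergeable ∷ []) = absorb-unmergeable c unmergeable
  absorb-collapse black u (_ ∷ _) _ = refl
  absorb-collapse white u (_ ∷ _) _ = refl

  collapse-absorb : ∀ c {t} → Normal t → collapse c (absorb c t) ≡ t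
  collapse-absorb black {int black (u ∷ _ ∷ _)} _ = refl
  collapse-absorb white {int white (u ∷ _ ∷ _)} _ = refl
  collapse-absorb black {int black (u ∷ [])} (int () _)
  collapse-absorb white {int white (u ∷ [])} (int () _)
  collapse-absorb black {bd} _ = refl
  collapse-absorb white {bd} _ = refl
  collapse-absorb black {int white _} _ = refl
  collapse-absorb white {int black _} _ = refl
  collapse-absorb black {int black []} _ = refl
  collapse-absorb white {int white []} _ = refl

  absorb-nonEmpty : ∀ c t → Σ PT λ u → Σ (List PT) λ us → absorb c t ≡ u ∷ us
  absorb-nonEmpty black (int black (u ∷ us)) = u , us , refl
  absorb-nonEmpty white (int white (u ∷ us)) = u , us , refl
  absorb-nonEmpty black bd = _ , _ , refl
  absorb-nonEmpty white bd = _ , _ , refl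
  absorb-nonEmpty black (int white _) = _ , _ , refl
  absorb-nonEmpty white (int black _) = _ , _ , refl
  absorb-nonEmpty black (int black []) = _ , _ , refl
  absorb-nonEmpty white (int white []) = _ , _ , refl

  nf-contract : ∀ c y ys → absorb c (nf (int c (y ∷ ys))) ≡ nfChildren c (y ∷ ys)
  nf-contract c y ys with absorb-nonEmpty c (nf y) | nfChildren-normal c (y ∷ ys)
  ... | u , us , eq | children rewrite eq =
    absorb-collapse c u (us ++ nfChildren c ys) (All.map proj₁ children)

  nf-move : ∀ {t t′} → Move t t′ → nf t ≡ nf t′
  nf-move (contract c xs y ys zs) = cong (collapse c) (begin
    nfChildren c (xs ++ int c (y ∷ ys) ∷ zs)
      ≡⟨ nfChildren-++ c xs _ ⟩
    nfChildren c xs ++ absorb c (nf (int c (y ∷ ys))) ++ nfChildren c zs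
      ≡⟨ cong (λ l → nfChildren c xs ++ l ++ nfChildren c zs) (nf-contract c y ys) ⟩
    nfChildren c xs ++ nfChildren c (y ∷ ys) ++ nfChildren c zs
      ≡⟨ cong (nfChildren c xs ++_) (nfChildren-++ c (y ∷ ys) zs) ⟨
    nfChildren c xs ++ nfChildren c ((y ∷ ys) ++ zs)
      ≡⟨ nfChildren-++ c xs _ ⟨
    nfChildren c (xs ++ (y ∷ ys) ++ zs) ∎)
    where open ≡-Reasoning
  nf-move (removeDeg2 c t) =
    trans (cong (collapse c) (++-identityʳ (absorb c (nf t)))) (collapse-absorb c (nf-normal t))
  nf-move (inside c xs zs {t} {t′} m) = cong (collapse c) (begin
    nfChildren c (xs ++ t ∷ zs)                        ≡⟨ nfChildren-++ c xs _ ⟩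
    nfChildren c xs ++ absorb c (nf t) ++ nfChildren c zs
      ≡⟨ cong (λ s → nfChildren c xs ++ absorb c s ++ nfChildren c zs) (nf-move m) ⟩
    nfChildren c xs ++ absorb c (nf t′) ++ nfChildren c zs ≡⟨ nfChildren-++ c xs _ ⟨
    nfChildren c (xs ++ t′ ∷ zs)                       ∎)
    where open ≡-Reasoning

  infix 4 _⇒*_
  _⇒*_ : PT → PT → Set
  _⇒*_ = Star Move

  inside* : ∀ c xs zs {t t′} → t ⇒* t′ → int c (xs ++ t ∷ zs) ⇒* int c (xs ++ t′ ∷ zs)
  inside* c xs zs = Star.gmap (λ t → int c (xs ++ t ∷ zs)) (inside c xs zs)

  absorb* : ∀ c xs t zs → int c (xs ++ t ∷ zs) ⇒* int c (xs ++ absorb c t ++ zs)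
  absorb* black xs (int black (u ∷ us)) zs = contract black xs u us zs ◅ ε
  absorb* white xs (int white (u ∷ us)) zs = contract white xs u us zs ◅ ε
  absorb* black xs bd zs = ε
  absorb* white xs bd zs = ε
  absorb* black xs (int white _) zs = ε
  absorb* white xs (int black _) zs = ε
  absorb* black xs (int black []) zs = ε
  absorb* white xs (int white []) zs = ε

  collapse* : ∀ c us → int c us ⇒* collapse c us
  collapse* c [] = ε
  collapse* c (u ∷ []) = removeDeg2 c u ◅ ε
  collapse* c (_ ∷ _ ∷ _) = ε

  mutual
    ⇒*nf : ∀ t → t ⇒* nf t
    ⇒*nf bd = ε
    ⇒*nf (int c ts) = ⇒*nfChildren c [] ts ◅◅ collapse* c (nfChildren c ts)

    ⇒*nfChildren : ∀ c xs ts → int c (xs ++ ts) ⇒* int c (xs ++ nfChildren c ts)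
    ⇒*nfChildren c xs [] = ε
    ⇒*nfChildren c xs (t ∷ ts) =
      inside* c xs ts (⇒*nf t) ◅◅ absorb* c xs (nf t) ts ◅◅
      subst₂ (λ l l′ → int c l ⇒* int c l′) (++-assoc xs _ ts) (++-assoc xs _ (nfChildren c ts))
        (⇒*nfChildren c (xs ++ absorb c (nf t)) ts)

  ⇒*⇒≈ₘ : ∀ {t t′} → t ⇒* t′ → t ≈ₘ t′
  ⇒*⇒≈ₘ = Star.map fwd

  ≈ₘ⇒nf≡ : ∀ {t t′} → t ≈ₘ t′ → nf t ≡ nf t′
  ≈ₘ⇒nf≡ = EqClosure.gfold isEquivalence nf nf-move

  nf≡⇒≈ₘ : ∀ {t t′} → nf t ≡ nf t′ → t ≈ₘ t′
  nf≡⇒≈ₘ {t} {t′} eq =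
    ⇒*⇒≈ₘ (⇒*nf t) ◅◅ subst (_≈ₘ t′) (sym eq) (EqClosure.symmetric Move (⇒*⇒≈ₘ (⇒*nf t′)))

open NormalForms

module MoveInvariants where
  open import Data.Nat as ℕ using (ℕ; zero; suc)
  import Data.Nat.Properties as ℕ
  open import Data.Integer as ℤ using (ℤ; +_)
  import Data.Integer.Properties as ℤ
  open import Data.Integer.Tactic.RingSolver using (solve-∀)
  open import Data.List using (List; []; _∷_; _++_; [_]; length)
  open import Data.List.Properties using (length-++)
  open import Data.Product using (_×_; _,_; proj₁; proj₂)
  open import Data.Unit using (tt)
  open import Function using (_∘_)
  open import Relation.Binary.PropositionalEquality hiding ([_])
  open import Relation.Binary.Construct.Closure.ReflexiveTransitive as Star using (Star; ε; _◅_)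

  nBdL-++ : ∀ xs ys → nBdL (xs ++ ys) ≡ nBdL xs ℕ.+ nBdL ys
  nBdL-++ [] ys = refl
  nBdL-++ (x ∷ xs) ys = trans (cong (nBd x ℕ.+_) (nBdL-++ xs ys)) (sym (ℕ.+-assoc (nBd x) _ _))

  defectL-++ : ∀ xs ys → defectL (xs ++ ys) ≡ defectL xs ℤ.+ defectL ys
  defectL-++ [] ys = sym (ℤ.+-identityˡ _)
  defectL-++ (x ∷ xs) ys = trans (cong (λ z → defect x ℤ.+ z) (defectL-++ xs ys)) (sym (ℤ.+-assoc (defect x) _ _))

  defect-black : ∀ ts → defect (int black ts) ≡ (+ length ts ℤ.- + 1) ℤ.+ defectL ts
  defect-black ts = cong (ℤ._+ defectL ts) (suc-minus-two (length ts))
    where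
    suc-minus-two : ∀ n → + suc n ℤ.- + 2 ≡ + n ℤ.- + 1
    suc-minus-two zero = refl
    suc-minus-two (suc n) = refl

  length-middle : ∀ xs (t : PT) zs → + length (xs ++ t ∷ zs) ≡ + length xs ℤ.+ (+ 1 ℤ.+ + length zs)
  length-middle xs t zs = trans (cong +_ (length-++ xs)) (ℤ.pos-+ (length xs) _)

  nBd-move : ∀ {t t′} → Move t t′ → nBd t ≡ nBd t′
  nBd-move (contract c xs y ys zs) = begin
    nBdL (xs ++ int c (y ∷ ys) ∷ zs)            ≡⟨ nBdL-++ xs _ ⟩
    nBdL xs ℕ.+ (nBdL (y ∷ ys) ℕ.+ nBdL zs)     ≡⟨ cong (nBdL xs ℕ.+_) (nBdL-++ (y ∷ ys) zs) ⟨
    nBdL xs ℕ.+ nBdL ((y ∷ ys) ++ zs)           ≡⟨ nBdL-++ xs _ ⟨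
    nBdL (xs ++ (y ∷ ys) ++ zs)                 ∎
    where open ≡-Reasoning
  nBd-move (removeDeg2 c t) = ℕ.+-identityʳ (nBd t)
  nBd-move (inside c xs zs m) =
    trans (nBdL-++ xs _) (trans (cong (λ n → nBdL xs ℕ.+ (n ℕ.+ nBdL zs)) (nBd-move m)) (sym (nBdL-++ xs _)))

  defectL-inside : ∀ xs zs {t t′} → defect t ≡ defect t′ → defectL (xs ++ t ∷ zs) ≡ defectL (xs ++ t′ ∷ zs)
  defectL-inside xs zs eq =
    trans (defectL-++ xs _) (trans (cong (λ d → defectL xs ℤ.+ (d ℤ.+ defectL zs)) eq) (sym (defectL-++ xs _)))

  defect-move : ∀ {t t′} → Move t t′ → defect t ≡ defect t′
  defect-move (contract white xs y ys zs) = begin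
    defectL (xs ++ int white (y ∷ ys) ∷ zs)            ≡⟨ defectL-++ xs _ ⟩
    defectL xs ℤ.+ (defectL (y ∷ ys) ℤ.+ defectL zs)   ≡⟨ cong (λ z → defectL xs ℤ.+ z) (defectL-++ (y ∷ ys) zs) ⟨
    defectL xs ℤ.+ defectL ((y ∷ ys) ++ zs)            ≡⟨ defectL-++ xs _ ⟨
    defectL (xs ++ (y ∷ ys) ++ zs)                     ∎
    where open ≡-Reasoning
  defect-move (contract black xs y ys zs) = begin
    defect (int black (xs ++ int black (y ∷ ys) ∷ zs))
      ≡⟨ defect-black (xs ++ int black (y ∷ ys) ∷ zs) ⟩
    (+ length (xs ++ int black (y ∷ ys) ∷ zs) ℤ.- + 1) ℤ.+ defectL (xs ++ int black (y ∷ ys) ∷ zs)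
      ≡⟨ cong₂ (λ l d → (l ℤ.- + 1) ℤ.+ d) (length-middle xs _ zs)
           (trans (defectL-++ xs _) (cong (λ d → defectL xs ℤ.+ (d ℤ.+ defectL zs)) (defect-black (y ∷ ys)))) ⟩
    (a ℤ.+ (+ 1 ℤ.+ c) ℤ.- + 1) ℤ.+ (d ℤ.+ (((+ 1 ℤ.+ b) ℤ.- + 1 ℤ.+ e) ℤ.+ f))
      ≡⟨ regroup a b c d e f ⟩
    (a ℤ.+ ((+ 1 ℤ.+ b) ℤ.+ c) ℤ.- + 1) ℤ.+ (d ℤ.+ (e ℤ.+ f))
      ≡⟨ cong₂ (λ l d → (l ℤ.- + 1) ℤ.+ d)
           (trans (cong +_ (length-++ xs)) (trans (ℤ.pos-+ (length xs) _) (cong (λ z → a ℤ.+ z) (trans (cong +_ (length-++ (y ∷ ys))) (ℤ.pos-+ (suc (length ys)) _)))))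
           (trans (defectL-++ xs _) (cong (λ z → d ℤ.+ z) (defectL-++ (y ∷ ys) zs))) ⟨
    (+ length (xs ++ (y ∷ ys) ++ zs) ℤ.- + 1) ℤ.+ defectL (xs ++ (y ∷ ys) ++ zs)
      ≡⟨ defect-black (xs ++ (y ∷ ys) ++ zs) ⟨
    defect (int black (xs ++ (y ∷ ys) ++ zs)) ∎
    where
    open ≡-Reasoning
    a = + length xs
    b = + length ys
    c = + length zs
    d = defectL xs
    e = defectL (y ∷ ys)
    f = defectL zs
    regroup : ∀ a b c d e f → (a ℤ.+ (+ 1 ℤ.+ c) ℤ.- + 1) ℤ.+ (d ℤ.+ (((+ 1 ℤ.+ b) ℤ.- + 1 ℤ.+ e) ℤ.+ f))
                            ≡ (a ℤ.+ ((+ 1 ℤ.+ b) ℤ.+ c) ℤ.- + 1) ℤ.+ (d ℤ.+ (e ℤ.+ f))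
    regroup = solve-∀
  defect-move (removeDeg2 white t) = ℤ.+-identityʳ (defect t)
  defect-move (removeDeg2 black t) = trans (ℤ.+-identityˡ _) (ℤ.+-identityʳ (defect t))
  defect-move (inside white xs zs m) = defectL-inside xs zs (defect-move m)
  defect-move (inside black xs zs {t} {t′} m) =
    trans (defect-black (xs ++ t ∷ zs))
      (trans (cong₂ (λ l d → (+ l ℤ.- + 1) ℤ.+ d) (trans (length-++ xs) (sym (length-++ xs))) (defectL-inside xs zs (defect-move m)))
        (sym (defect-black (xs ++ t′ ∷ zs))))

  WFL-++⁻ : ∀ xs {ys} → WFL (xs ++ ys) → WFL xs × WFL ys
  WFL-++⁻ [] w = tt , w
  WFL-++⁻ (x ∷ xs) (w , ws) = let (ws₁ , ws₂) = WFL-++⁻ xs ws in (w , ws₁) , ws₂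

  WFL-++⁺ : ∀ xs {ys} → WFL xs → WFL ys → WFL (xs ++ ys)
  WFL-++⁺ [] _ w = w
  WFL-++⁺ (x ∷ xs) (w , ws) w′ = w , WFL-++⁺ xs ws w′

  WF-int⁻ : ∀ c xs t zs → WF (int c (xs ++ t ∷ zs)) → WFL (xs ++ t ∷ zs)
  WF-int⁻ c [] t zs w = w
  WF-int⁻ c (_ ∷ _) t zs w = w

  WF-int⁺ : ∀ c xs t zs → WFL (xs ++ t ∷ zs) → WF (int c (xs ++ t ∷ zs))
  WF-int⁺ c [] t zs w = w
  WF-int⁺ c (_ ∷ _) t zs w = w

  WF-move : ∀ {t t′} → Move t t′ → WF t → WF t′
  WF-move (contract c xs y ys zs) w =
    let (wxs , (wy , wys) , wzs) = WFL-++⁻ xs (WF-int⁻ c xs _ zs w)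
    in WF-int⁺ c xs y (ys ++ zs) (WFL-++⁺ xs wxs (wy , WFL-++⁺ ys wys wzs))
  WF-move (removeDeg2 c t) (w , _) = w
  WF-move (inside c xs zs {t} {t′} m) w =
    let (wxs , wt , wzs) = WFL-++⁻ xs (WF-int⁻ c xs t zs w)
    in WF-int⁺ c xs t′ zs (WFL-++⁺ xs wxs (WF-move m wt , wzs))

  record SizeInvariant (P : PT → Set) : Set where
    field
      transfer : ∀ {s s′} → nBd s ≡ nBd s′ → defect s ≡ defect s′ → P s → P s′

  open SizeInvariant public

  EveryL-++⁻ : ∀ {P} xs {ys} → EveryL P (xs ++ ys) → EveryL P xs × EveryL P ys
  EveryL-++⁻ [] e = tt , e
  EveryL-++⁻ (x ∷ xs) (e , es) = let (es₁ , es₂) = EveryL-++⁻ xs es in (e , es₁) , es₂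

  EveryL-++⁺ : ∀ {P} xs {ys} → EveryL P xs → EveryL P ys → EveryL P (xs ++ ys)
  EveryL-++⁺ [] _ e = e
  EveryL-++⁺ (x ∷ xs) (e , es) e′ = e , EveryL-++⁺ xs es e′

  Every-root : ∀ {P} t → Every P t → P t
  Every-root bd p = p
  Every-root (int c ts) (p , _) = p

  Every-move : ∀ {P} → SizeInvariant P → ∀ {t t′} → Move t t′ → Every P t → Every P t′
  Every-move inv m@(contract c xs y ys zs) (p , es) =
    let (exs , (_ , eys) , ezs) = EveryL-++⁻ xs es
    in transfer inv (nBd-move m) (defect-move m) p , EveryL-++⁺ xs exs (EveryL-++⁺ (y ∷ ys) eys ezs)
  Every-move inv (removeDeg2 c t) (_ , e , _) = e
  Every-move inv m@(inside c xs zs m′) (p , es) =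
    let (exs , et , ezs) = EveryL-++⁻ xs es
    in transfer inv (nBd-move m) (defect-move m) p , EveryL-++⁺ xs exs (Every-move inv m′ et , ezs)

  mutual
    Every-map : ∀ {P Q : PT → Set} → (∀ {s} → P s → Q s) → ∀ t → Every P t → Every Q t
    Every-map f bd p = f p
    Every-map f (int c ts) (p , es) = f p , EveryL-map f ts es

    EveryL-map : ∀ {P Q : PT → Set} → (∀ {s} → P s → Q s) → ∀ ts → EveryL P ts → EveryL Q ts
    EveryL-map f [] _ = tt
    EveryL-map f (t ∷ ts) (e , es) = Every-map f t e , EveryL-map f ts es

  preserved* : ∀ {Q : PT → Set} → (∀ {t t′} → Move t t′ → Q t → Q t′) → ∀ {t t′} → t ⇒* t′ → Q t → Q t′
  preserved* {Q} step = Star.fold (λ t t′ → Q t → Q t′) (λ m k → k ∘ step m) (λ q → q)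

  invariant* : ∀ {A : Set} (f : PT → A) → (∀ {t t′} → Move t t′ → f t ≡ f t′) → ∀ {t t′} → t ⇒* t′ → f t ≡ f t′
  invariant* f step {t} path = preserved* {λ s → f t ≡ f s} (λ m eq → trans eq (step m)) path refl

  excess : ℕ → PT → ℤ
  excess M S = + nBd S ℤ.- + M ℤ.* defect S

  EdgeBalanced : ℕ → PT → Set
  EdgeBalanced M S = InRange M (excess M S)

  EdgeBalanced-invariant : ∀ M → SizeInvariant (EdgeBalanced M)
  EdgeBalanced-invariant M = record { transfer = subst₂ (λ n d → InRange M (+ n ℤ.- + M ℤ.* d)) }

  InRange-reflect : ∀ M {x} → InRange M x → InRange M ((+ M ℤ.+ + 1) ℤ.- x)
  InRange-reflect M {x} (1≤x , x≤M) =
    subst (ℤ._≤ (+ M ℤ.+ + 1) ℤ.- x) (cancel (+ M) (+ 1)) (ℤ.+-monoʳ-≤ (+ M ℤ.+ + 1) (ℤ.neg-mono-≤ x≤M)) ,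
    subst ((+ M ℤ.+ + 1) ℤ.- x ℤ.≤_) (cancelʳ (+ M) (+ 1)) (ℤ.+-monoʳ-≤ (+ M ℤ.+ + 1) (ℤ.neg-mono-≤ 1≤x))
    where
    cancel : ∀ a b → (a ℤ.+ b) ℤ.- a ≡ b
    cancel = solve-∀
    cancelʳ : ∀ a b → (a ℤ.+ b) ℤ.- b ≡ a
    cancelʳ = solve-∀

  Balanced⇒Every : ∀ M T → Balanced M T → Every (EdgeBalanced M) T
  Balanced⇒Every M T = Every-map proj₁ T

  Every⇒Balanced : ∀ M T → nTotal T ≡ 3 ℕ.* M ℕ.+ 1 → defect T ≡ + 2 → Every (EdgeBalanced M) T → Balanced M T
  Every⇒Balanced M T total≡ defect≡ = Every-map (λ {S} b → b , subst (InRange M) (other-side S) (InRange-reflect M b)) T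
    where
    identity : ∀ M n d → (M ℤ.+ + 1) ℤ.- (n ℤ.- M ℤ.* d) ≡ ((+ 3 ℤ.* M ℤ.+ + 1) ℤ.- n) ℤ.- M ℤ.* (+ 2 ℤ.- d)
    identity = solve-∀
    total-ℤ : + nTotal T ≡ + 3 ℤ.* + M ℤ.+ + 1
    total-ℤ = trans (cong +_ total≡) (trans (ℤ.pos-+ (3 ℕ.* M) 1) (cong (ℤ._+ + 1) (ℤ.pos-* 3 M)))
    other-side : ∀ S → (+ M ℤ.+ + 1) ℤ.- excess M S ≡ (+ nTotal T ℤ.- + nBd S) ℤ.- + M ℤ.* (defect T ℤ.- defect S)
    other-side S = trans (identity (+ M) (+ nBd S) (defect S))
      (cong₂ (λ N D → (N ℤ.- + nBd S) ℤ.- + M ℤ.* (D ℤ.- defect S)) (sym total-ℤ) (sym defect≡))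

open MoveInvariants

module Bipartization where
  open import Data.Nat as ℕ using (ℕ; zero; suc)
  import Data.Nat.Properties as ℕ
  open import Data.Integer as ℤ using (ℤ; +_)
  import Data.Integer.Properties as ℤ
  open import Data.Integer.Tactic.RingSolver using (solve-∀)
  open import Data.List using (List; []; _∷_; _++_; [_]; length)
  open import Data.List.Properties using (length-++)
  open import Data.Product using (_×_; _,_; proj₁; proj₂)
  open import Data.Unit using (tt)
  open import Function using (_∘_)
  open import Relation.Binary.PropositionalEquality hiding ([_])
  open import Relation.Binary.Construct.Closure.ReflexiveTransitive as Star using (Star; ε; _◅_)

  pad : Colour → PT → PT
  pad black bd = int white [ bd ]
  pad white bd = bd
  pad black (int black ts) = int white [ int black ts ]
  pad white (int white ts) = int black [ int white ts ]
  pad black (int white ts) = int white ts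
  pad white (int black ts) = int black ts

  data Padding (p : Colour) (t : PT) : PT → Set where
    unchanged  : Padding p t t
    subdivided : Padding p t (int (flip p) [ t ])

  padding : ∀ p t → Padding p t (pad p t)
  padding black bd = subdivided
  padding white bd = unchanged
  padding black (int black ts) = subdivided
  padding white (int white ts) = subdivided
  padding black (int white ts) = unchanged
  padding white (int black ts) = unchanged

  module _ {p : Colour} {t : PT} where
    Padding-nBd : ∀ {t′} → Padding p t t′ → nBd t′ ≡ nBd t
    Padding-nBd unchanged = refl
    Padding-nBd subdivided = nBd-move (removeDeg2 (flip p) t)

    Padding-defect : ∀ {t′} → Padding p t t′ → defect t′ ≡ defect t
    Padding-defect unchanged = refl
    Padding-defect subdivided = defect-move (removeDeg2 (flip p) t)

    Padding-WF : ∀ {t′} → Padding p t t′ → WF t → WF t′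
    Padding-WF unchanged w = w
    Padding-WF subdivided w = w , tt

    Padding-Every : ∀ {P t′} → SizeInvariant P → Padding p t t′ → Every P t → Every P t′
    Padding-Every inv unchanged e = e
    Padding-Every {t′ = t′} inv subdivided e =
      transfer inv (sym (Padding-nBd subdivided)) (sym (Padding-defect subdivided)) (Every-root t e) , e , tt

    Padding-nf : ∀ {t′} → Padding p t t′ → nf t′ ≡ nf t
    Padding-nf unchanged = refl
    Padding-nf subdivided = nf-move (removeDeg2 (flip p) t)

  mutual
    bipartize : Colour → PT → PT
    bipartize p bd = pad p bd
    bipartize p (int c ts) = pad p (int c (bipartizeChildren c ts))

    bipartizeChildren : Colour → List PT → List PT
    bipartizeChildren c [] = []
    bipartizeChildren c (t ∷ ts) = bipartize c t ∷ bipartizeChildren c ts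

  pad-bipartite : ∀ p c {ts} → BipL c ts → Bip p (pad p (int c ts))
  pad-bipartite black black b = refl , (refl , b) , tt
  pad-bipartite white white b = refl , (refl , b) , tt
  pad-bipartite black white b = refl , b
  pad-bipartite white black b = refl , b

  mutual
    bipartize-bipartite : ∀ p t → Bip p (bipartize p t)
    bipartize-bipartite black bd = refl , refl , tt
    bipartize-bipartite white bd = refl
    bipartize-bipartite p (int c ts) = pad-bipartite p c (bipartizeChildren-bipartite c ts)

    bipartizeChildren-bipartite : ∀ c ts → BipL c (bipartizeChildren c ts)
    bipartizeChildren-bipartite c [] = tt
    bipartizeChildren-bipartite c (t ∷ ts) = bipartize-bipartite c t , bipartizeChildren-bipartite c ts

  mutual
    nBd-bipartize : ∀ p t → nBd (bipartize p t) ≡ nBd t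
    nBd-bipartize p bd = Padding-nBd (padding p bd)
    nBd-bipartize p (int c ts) = trans (Padding-nBd (padding p _)) (nBdL-bipartize c ts)

    nBdL-bipartize : ∀ c ts → nBdL (bipartizeChildren c ts) ≡ nBdL ts
    nBdL-bipartize c [] = refl
    nBdL-bipartize c (t ∷ ts) = cong₂ ℕ._+_ (nBd-bipartize c t) (nBdL-bipartize c ts)

  length-bipartizeChildren : ∀ c ts → length (bipartizeChildren c ts) ≡ length ts
  length-bipartizeChildren c [] = refl
  length-bipartizeChildren c (t ∷ ts) = cong suc (length-bipartizeChildren c ts)

  mutual
    defect-bipartize : ∀ p t → defect (bipartize p t) ≡ defect t
    defect-bipartize p bd = Padding-defect (padding p bd)
    defect-bipartize p (int c ts) = trans (Padding-defect (padding p _)) (defect-bipartizeChildren c ts)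

    defect-bipartizeChildren : ∀ c ts → defect (int c (bipartizeChildren c ts)) ≡ defect (int c ts)
    defect-bipartizeChildren white ts = defectL-bipartize white ts
    defect-bipartizeChildren black ts =
      cong₂ (λ n d → (+ suc n ℤ.- + 2) ℤ.+ d) (length-bipartizeChildren black ts) (defectL-bipartize black ts)

    defectL-bipartize : ∀ c ts → defectL (bipartizeChildren c ts) ≡ defectL ts
    defectL-bipartize c [] = refl
    defectL-bipartize c (t ∷ ts) = cong₂ ℤ._+_ (defect-bipartize c t) (defectL-bipartize c ts)

  mutual
    WF-bipartize : ∀ p t → WF t → WF (bipartize p t)
    WF-bipartize p bd w = Padding-WF (padding p bd) w
    WF-bipartize p (int c (t ∷ ts)) w = Padding-WF (padding p _) (WFL-bipartize c (t ∷ ts) w)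

    WFL-bipartize : ∀ c ts → WFL ts → WFL (bipartizeChildren c ts)
    WFL-bipartize c [] _ = tt
    WFL-bipartize c (t ∷ ts) (w , ws) = WF-bipartize c t w , WFL-bipartize c ts ws

  module _ {P : PT → Set} (inv : SizeInvariant P) where
    mutual
      Every-bipartize : ∀ p t → Every P t → Every P (bipartize p t)
      Every-bipartize p bd e = Padding-Every inv (padding p bd) e
      Every-bipartize p (int c ts) (q , es) =
        Padding-Every inv (padding p _) (transfer inv (sym (nBdL-bipartize c ts)) (sym (defect-bipartizeChildren c ts)) q , EveryL-bipartize c ts es)

      EveryL-bipartize : ∀ c ts → EveryL P ts → EveryL P (bipartizeChildren c ts)
      EveryL-bipartize c [] _ = tt
      EveryL-bipartize c (t ∷ ts) (e , es) = Every-bipartize c t e , EveryL-bipartize c ts es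

  mutual
    nf-bipartize : ∀ p t → nf (bipartize p t) ≡ nf t
    nf-bipartize p bd = Padding-nf (padding p bd)
    nf-bipartize p (int c ts) = trans (Padding-nf (padding p _)) (cong (collapse c) (nfChildren-bipartize c ts))

    nfChildren-bipartize : ∀ c ts → nfChildren c (bipartizeChildren c ts) ≡ nfChildren c ts
    nfChildren-bipartize c [] = refl
    nfChildren-bipartize c (t ∷ ts) = cong₂ (λ s l → absorb c s ++ l) (nf-bipartize c t) (nfChildren-bipartize c ts)

open Bipartization

module Shapes where
  open import Data.Nat using (ℕ; zero; suc; _+_; _∸_; _≤_; z≤n; s≤s)
  import Data.Nat.Properties as ℕ
  open import Data.Integer as ℤ using (ℤ; +_)
  import Data.Integer.Properties as ℤ
  open import Data.List using (List; []; _∷_; _++_; [_]; length; replicate)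
  open import Data.List.Properties using (length-replicate; ∷-injective)
  open import Data.List.Relation.Unary.All using (All; []; _∷_)
  open import Data.List.Relation.Unary.All.Properties using (++⁺; ++⁻ʳ)
  open import Data.Product using (Σ; ∃; ∃₂; _×_; _,_; proj₁; proj₂)
  open import Data.Sum using (_⊎_; inj₁; inj₂)
  open import Data.Unit using (tt)
  open import Data.Empty using (⊥; ⊥-elim)
  open import Relation.Binary.PropositionalEquality hiding ([_])

  leaves : ℕ → List PT
  leaves n = replicate n bd

  fan : ℕ → PT
  fan zero = bd
  fan (suc a) = int white (leaves (suc (suc a)))

  cherry : ℕ → ℕ → PT
  cherry a b = int black (fan a ∷ fan b ∷ [])

  around : ℕ → PT → ℕ → List PT
  around q X p = leaves q ++ X ∷ leaves p

  branch : ℕ → ℕ → ℕ → ℕ → PT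
  branch L₁ a b L₂ = int white (around L₁ (cherry a b) L₂)

  data Side : Set where
    left right : Side

  pair : Side → PT → PT → List PT
  pair left x y = x ∷ y ∷ []
  pair right x y = y ∷ x ∷ []

  data Core : Set where
    tripod : (a b c : ℕ) → Core
    fork   : Side → (y L₁ z₁ z₂ L₂ : ℕ) → Core

  coreChildren : Core → List PT
  coreChildren (tripod a b c) = fan a ∷ fan b ∷ fan c ∷ []
  coreChildren (fork s y L₁ z₁ z₂ L₂) = pair s (fan y) (branch L₁ z₁ z₂ L₂)

  core : Core → PT
  core X = int black (coreChildren X)

  data Code : Set where
    one : (q : ℕ) → Core → (p : ℕ) → Code
    two : (q z₁ z₂ r y₁ y₂ p : ℕ) → Code

  rootChildren : Code → List PT
  rootChildren (one q X p) = around q (core X) p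
  rootChildren (two q z₁ z₂ r y₁ y₂ p) = leaves q ++ cherry z₁ z₂ ∷ around r (cherry y₁ y₂) p

  children : PT → List PT
  children bd = []
  children (int _ ts) = ts

  shape : Code → PT
  shape (one zero X zero) = core X
  shape c = int white (rootChildren c)

  mutual
    defectℕ : PT → ℕ
    defectℕ bd = 0
    defectℕ (int white ts) = defectℕL ts
    defectℕ (int black ts) = (length ts ∸ 1) + defectℕL ts

    defectℕL : List PT → ℕ
    defectℕL [] = 0
    defectℕL (t ∷ ts) = defectℕ t + defectℕL ts

  mutual
    defect-WF : ∀ t → WF t → defect t ≡ + defectℕ t
    defect-WF bd _ = refl
    defect-WF (int white (t ∷ ts)) w = defectL-WF (t ∷ ts) w
    defect-WF (int black (t ∷ ts)) w =
      trans (cong (ℤ._+_ (+ length ts)) (defectL-WF (t ∷ ts) w)) (sym (ℤ.pos-+ (length ts) _))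

    defectL-WF : ∀ ts → WFL ts → defectL ts ≡ + defectℕL ts
    defectL-WF [] _ = refl
    defectL-WF (t ∷ ts) (w , ws) =
      trans (cong₂ ℤ._+_ (defect-WF t w) (defectL-WF ts ws)) (sym (ℤ.pos-+ (defectℕ t) _))

  data Child (c : Colour) : PT → Set where
    leaf : Child c bd
    node : ∀ v w ws → Child c (int (flip c) (v ∷ w ∷ ws))

  child : ∀ c {u} → Unmergeable c u → Normal u → WF u → Child c u
  child black {bd} _ _ _ = leaf
  child white {bd} _ _ _ = leaf
  child black {int white (v ∷ w ∷ ws)} _ _ _ = node v w ws
  child white {int black (v ∷ w ∷ ws)} _ _ _ = node v w ws
  child _ {int _ (_ ∷ [])} _ (int () _) _
  child _ {int _ []} _ _ ()

  +≡0 : ∀ m {n} → m + n ≡ 0 → m ≡ 0 × n ≡ 0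
  +≡0 m eq = ℕ.m+n≡0⇒m≡0 m eq , ℕ.m+n≡0⇒n≡0 m eq

  +≡1 : ∀ m {n} → m + n ≡ 1 → (m ≡ 0 × n ≡ 1) ⊎ (m ≡ 1 × n ≡ 0)
  +≡1 zero eq = inj₁ (refl , eq)
  +≡1 (suc zero) {zero} _ = inj₂ (refl , refl)

  whiteChildren₀ : ∀ {us} → NormalChildren white us → WFL us → defectℕL us ≡ 0 → ∃ λ q → us ≡ leaves q
  whiteChildren₀ {[]} [] _ _ = 0 , refl
  whiteChildren₀ {u ∷ us} ((unmergeable , n) ∷ ns) (w , ws) eq with child white unmergeable n w
  ... | leaf = let (q , us≡) = whiteChildren₀ ns ws eq in suc q , cong (bd ∷_) us≡

  fan-of-defect₀ : ∀ {u} → Unmergeable black u → Normal u → WF u → defectℕ u ≡ 0 → ∃ λ a → u ≡ fan a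
  fan-of-defect₀ unmergeable n w eq with child black unmergeable n w
  fan-of-defect₀ _ _ _ _ | leaf = 0 , refl
  fan-of-defect₀ _ (int _ ns) w eq | node v v′ vs with whiteChildren₀ ns w eq
  ... | suc (suc a) , refl = suc a , refl

  cherry-of-defect₁ : ∀ {us} → Normal (int black us) → WF (int black us) → defectℕ (int black us) ≡ 1 →
    ∃₂ λ a b → int black us ≡ cherry a b
  cherry-of-defect₁ {u ∷ v ∷ []} (int _ ((nu , u-normal) ∷ (nv , v-normal) ∷ [])) (wu , wv , _) eq
    with +≡0 (defectℕ u) (ℕ.suc-injective eq)
  ... | u≡0 , v≡0 with fan-of-defect₀ nu u-normal wu u≡0 | fan-of-defect₀ nv v-normal wv (trans (sym (ℕ.+-identityʳ _)) v≡0)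
  ... | a , refl | b , refl = a , b , refl

  whiteChildren₁ : ∀ {us} → NormalChildren white us → WFL us → defectℕL us ≡ 1 →
    Σ (ℕ × ℕ × ℕ × ℕ) λ (q , a , b , p) → us ≡ around q (cherry a b) p
  whiteChildren₁ {u ∷ us} ((unmergeable , n) ∷ ns) (w , ws) eq with child white unmergeable n w
  ... | leaf = let ((q , a , b , p) , us≡) = whiteChildren₁ ns ws eq in (suc q , a , b , p) , cong (bd ∷_) us≡
  ... | node v v′ vs with +≡0 (length vs + _) {defectℕL us} (ℕ.suc-injective eq)
  ...   | u≡0 , us≡0 with cherry-of-defect₁ n w (cong suc u≡0) | whiteChildren₀ ns ws us≡0
  ...     | a , b , refl | p , refl = (0 , a , b , p) , refl

  branch-of-defect₁ : ∀ {u} → Unmergeable black u → Normal u → WF u → defectℕ u ≡ 1 →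
    Σ (ℕ × ℕ × ℕ × ℕ) λ (L₁ , a , b , L₂) → u ≡ branch L₁ a b L₂
  branch-of-defect₁ unmergeable n w eq with child black unmergeable n w
  branch-of-defect₁ _ (int _ ns) w eq | node v v′ vs =
    let (L , us≡) = whiteChildren₁ ns w eq in L , cong (int white) us≡

  core-of-defect₂ : ∀ {us} → Normal (int black us) → WF (int black us) → defectℕ (int black us) ≡ 2 →
    ∃ λ X → int black us ≡ core X
  core-of-defect₂ {u ∷ v ∷ []} (int _ ((nu , u-normal) ∷ (nv , v-normal) ∷ [])) (wu , wv , _) eq
    with +≡1 (defectℕ u) (trans (cong (λ n → defectℕ u + n) (sym (ℕ.+-identityʳ _))) (ℕ.suc-injective eq))
  ... | inj₁ (u≡0 , v≡1) with fan-of-defect₀ nu u-normal wu u≡0 | branch-of-defect₁ nv v-normal wv v≡1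
  ...   | y , refl | (L₁ , z₁ , z₂ , L₂) , refl = fork left y L₁ z₁ z₂ L₂ , refl
  core-of-defect₂ {u ∷ v ∷ []} (int _ ((nu , u-normal) ∷ (nv , v-normal) ∷ [])) (wu , wv , _) eq
      | inj₂ (u≡1 , v≡0) with branch-of-defect₁ nu u-normal wu u≡1 | fan-of-defect₀ nv v-normal wv v≡0
  ...   | (L₁ , z₁ , z₂ , L₂) , refl | y , refl = fork right y L₁ z₁ z₂ L₂ , refl
  core-of-defect₂ {u ∷ v ∷ w ∷ []} (int _ ((nu , u-normal) ∷ (nv , v-normal) ∷ (nw , w-normal) ∷ [])) (wu , wv , ww , _) eq
    with +≡0 (defectℕ u) (ℕ.suc-injective (ℕ.suc-injective eq))
  ... | u≡0 , vw≡0 with +≡0 (defectℕ v) vw≡0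
  ...   | v≡0 , w≡0 with fan-of-defect₀ nu u-normal wu u≡0 | fan-of-defect₀ nv v-normal wv v≡0
                       | fan-of-defect₀ nw w-normal ww (trans (sym (ℕ.+-identityʳ _)) w≡0)
  ...     | a , refl | b , refl | c , refl = tripod a b c , refl

  shape-white : ∀ c → NotSingleton (rootChildren c) → shape c ≡ int white (rootChildren c)
  shape-white (one zero X (suc p)) _ = refl
  shape-white (one (suc q) X p) _ = refl
  shape-white (two q z₁ z₂ r y₁ y₂ p) _ = refl

  withLeaf : Code → Code
  withLeaf (one q X p) = one (suc q) X p
  withLeaf (two q z₁ z₂ r y₁ y₂ p) = two (suc q) z₁ z₂ r y₁ y₂ p

  rootChildren-withLeaf : ∀ c → rootChildren (withLeaf c) ≡ bd ∷ rootChildren c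
  rootChildren-withLeaf (one q X p) = refl
  rootChildren-withLeaf (two q z₁ z₂ r y₁ y₂ p) = refl

  whiteChildren₂ : ∀ {us} → NormalChildren white us → WFL us → defectℕL us ≡ 2 → ∃ λ c → us ≡ rootChildren c
  whiteChildren₂ {u ∷ us} ((unmergeable , n) ∷ ns) (w , ws) eq with child white unmergeable n w
  ... | leaf = let (c , us≡) = whiteChildren₂ ns ws eq in withLeaf c , trans (cong (bd ∷_) us≡) (sym (rootChildren-withLeaf c))
  ... | node v v′ vs with +≡1 (length vs + _) {defectℕL us} (ℕ.suc-injective eq)
  ...   | inj₁ (u≡0 , us≡1) with cherry-of-defect₁ n w (cong suc u≡0) | whiteChildren₁ ns ws us≡1
  ...     | z₁ , z₂ , refl | (r , y₁ , y₂ , p) , refl = two 0 z₁ z₂ r y₁ y₂ p , refl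
  whiteChildren₂ {u ∷ us} ((unmergeable , n) ∷ ns) (w , ws) eq | node v v′ vs
        | inj₂ (u≡1 , us≡0) with core-of-defect₂ n w (cong suc u≡1) | whiteChildren₀ ns ws us≡0
  ...     | X , u≡ | p , refl = one 0 X p , cong (_∷ leaves p) u≡

  classify : ∀ {N} → Normal N → WF N → defectℕ N ≡ 2 → ∃ λ c → N ≡ shape c
  classify {int black us} n w eq = let (X , N≡) = core-of-defect₂ n w eq in one 0 X 0 , N≡
  classify {int white (u ∷ us)} (int notSingleton ns) w eq =
    let (c , us≡) = whiteChildren₂ ns w eq
    in c , trans (cong (int white) us≡) (sym (shape-white c (subst NotSingleton us≡ notSingleton)))

  leaves-injective : ∀ {p p′} → leaves p ≡ leaves p′ → p ≡ p′
  leaves-injective {p} {p′} eq = trans (sym (length-replicate p)) (trans (cong length eq) (length-replicate p′))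

  leaves≢around : ∀ n q {c ts} ys → leaves n ≢ leaves q ++ int c ts ∷ ys
  leaves≢around zero zero ys ()
  leaves≢around (suc n) zero ys ()
  leaves≢around (suc n) (suc q) ys eq = leaves≢around n q ys (proj₂ (∷-injective eq))

  around-injective : ∀ q q′ {c c′ ts ts′ ys ys′} → leaves q ++ int c ts ∷ ys ≡ leaves q′ ++ int c′ ts′ ∷ ys′ →
    q ≡ q′ × int c ts ≡ int c′ ts′ × ys ≡ ys′
  around-injective zero zero refl = refl , refl , refl
  around-injective (suc q) (suc q′) eq =
    let (q≡ , X≡ , ys≡) = around-injective q q′ (proj₂ (∷-injective eq)) in cong suc q≡ , X≡ , ys≡

  fan-injective : ∀ {a a′} → fan a ≡ fan a′ → a ≡ a′
  fan-injective {zero} {zero} _ = refl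
  fan-injective {suc a} {suc a′} eq = ℕ.suc-injective (leaves-injective (cong children eq))

  fan≢branch : ∀ a L₁ z₁ z₂ L₂ → fan a ≢ branch L₁ z₁ z₂ L₂
  fan≢branch (suc a) L₁ z₁ z₂ L₂ eq = leaves≢around (suc (suc a)) L₁ (leaves L₂) (cong children eq)

  cherry-injective : ∀ {a b a′ b′} → cherry a b ≡ cherry a′ b′ → a ≡ a′ × b ≡ b′
  cherry-injective eq = let (a≡ , bs≡) = ∷-injective (cong children eq) in
    fan-injective a≡ , fan-injective (proj₁ (∷-injective bs≡))

  branch-injective : ∀ {L₁ a b L₂ L₁′ a′ b′ L₂′} → branch L₁ a b L₂ ≡ branch L₁′ a′ b′ L₂′ →
    L₁ ≡ L₁′ × a ≡ a′ × b ≡ b′ × L₂ ≡ L₂′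
  branch-injective {L₁} {L₁′ = L₁′} eq =
    let (L₁≡ , X≡ , L₂s≡) = around-injective L₁ L₁′ (cong children eq)
        (a≡ , b≡) = cherry-injective X≡
    in L₁≡ , a≡ , b≡ , leaves-injective L₂s≡

  fork-injective : ∀ {y y′ L₁ L₁′ z₁ z₁′ z₂ z₂′ L₂ L₂′} → fan y ≡ fan y′ → branch L₁ z₁ z₂ L₂ ≡ branch L₁′ z₁′ z₂′ L₂′ →
    ∀ s → fork s y L₁ z₁ z₂ L₂ ≡ fork s y′ L₁′ z₁′ z₂′ L₂′
  fork-injective y≡ b≡ s with fan-injective y≡ | branch-injective b≡
  ... | refl | refl , refl , refl , refl = refl

  core-injective : ∀ X X′ → core X ≡ core X′ → X ≡ X′
  core-injective (tripod a b c) (tripod a′ b′ c′) eq with cong children eq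
  ... | e with ∷-injective e
  ... | a≡ , e′ with ∷-injective e′
  ... | b≡ , e″ with fan-injective a≡ | fan-injective b≡ | fan-injective (proj₁ (∷-injective e″))
  ... | refl | refl | refl = refl
  core-injective (tripod a b c) (fork left y L₁ z₁ z₂ L₂) ()
  core-injective (tripod a b c) (fork right y L₁ z₁ z₂ L₂) ()
  core-injective (fork left y L₁ z₁ z₂ L₂) (fork left y′ L₁′ z₁′ z₂′ L₂′) eq =
    let (y≡ , e) = ∷-injective (cong children eq) in fork-injective y≡ (proj₁ (∷-injective e)) left
  core-injective (fork right y L₁ z₁ z₂ L₂) (fork right y′ L₁′ z₁′ z₂′ L₂′) eq =
    let (b≡ , e) = ∷-injective (cong children eq) in fork-injective (proj₁ (∷-injective e)) b≡ right
  core-injective (fork left y L₁ z₁ z₂ L₂) (fork right y′ L₁′ z₁′ z₂′ L₂′) eq =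
    ⊥-elim (fan≢branch y L₁′ z₁′ z₂′ L₂′ (proj₁ (∷-injective (cong children eq))))
  core-injective (fork right y L₁ z₁ z₂ L₂) (fork left y′ L₁′ z₁′ z₂′ L₂′) eq =
    ⊥-elim (fan≢branch y′ L₁ z₁ z₂ L₂ (sym (proj₁ (∷-injective (cong children eq)))))

  rootChildren-injective : ∀ c c′ → rootChildren c ≡ rootChildren c′ → c ≡ c′
  rootChildren-injective (one q X p) (one q′ X′ p′) eq with around-injective q q′ eq
  ... | refl , X≡ , p≡ with core-injective X X′ X≡ | leaves-injective p≡
  ... | refl | refl = refl
  rootChildren-injective (one q X p) (two q′ z₁ z₂ r y₁ y₂ p′) eq =
    ⊥-elim (leaves≢around p r _ (proj₂ (proj₂ (around-injective q q′ eq))))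
  rootChildren-injective (two q z₁ z₂ r y₁ y₂ p) (one q′ X′ p′) eq =
    ⊥-elim (leaves≢around p′ r _ (sym (proj₂ (proj₂ (around-injective q q′ eq)))))
  rootChildren-injective (two q z₁ z₂ r y₁ y₂ p) (two q′ z₁′ z₂′ r′ y₁′ y₂′ p′) eq
    with around-injective q q′ eq
  ... | refl , z≡ , rest≡ with around-injective r r′ rest≡ | cherry-injective z≡
  ... | refl , y≡ , p≡ | refl , refl with cherry-injective y≡ | leaves-injective p≡
  ... | refl , refl | refl = refl

  unshape : PT → List PT
  unshape bd = []
  unshape (int black ts) = int black ts ∷ []
  unshape (int white ts) = ts

  unshape-shape : ∀ c → unshape (shape c) ≡ rootChildren c
  unshape-shape (one zero X zero) = refl
  unshape-shape (one zero X (suc p)) = refl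
  unshape-shape (one (suc q) X p) = refl
  unshape-shape (two q z₁ z₂ r y₁ y₂ p) = refl

  shape-injective : ∀ {c c′} → shape c ≡ shape c′ → c ≡ c′
  shape-injective {c} {c′} eq =
    rootChildren-injective c c′ (trans (sym (unshape-shape c)) (trans (cong unshape eq) (unshape-shape c′)))

  nBdL-leaves : ∀ n → nBdL (leaves n) ≡ n
  nBdL-leaves zero = refl
  nBdL-leaves (suc n) = cong suc (nBdL-leaves n)

  defectL-leaves : ∀ n → defectL (leaves n) ≡ + 0
  defectL-leaves zero = refl
  defectL-leaves (suc n) = trans (ℤ.+-identityˡ _) (defectL-leaves n)

  nBdL-around : ∀ q X p → nBdL (around q X p) ≡ q + (nBd X + p)
  nBdL-around q X p = trans (nBdL-++ (leaves q) _) (cong₂ _+_ (nBdL-leaves q) (cong (λ n → nBd X + n) (nBdL-leaves p)))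

  defectL-around : ∀ q X p → defectL (around q X p) ≡ defect X
  defectL-around q X p = begin
    defectL (around q X p)                               ≡⟨ defectL-++ (leaves q) _ ⟩
    defectL (leaves q) ℤ.+ (defect X ℤ.+ defectL (leaves p)) ≡⟨ cong₂ (λ d e → d ℤ.+ (defect X ℤ.+ e)) (defectL-leaves q) (defectL-leaves p) ⟩
    + 0 ℤ.+ (defect X ℤ.+ + 0)                            ≡⟨ trans (ℤ.+-identityˡ _) (ℤ.+-identityʳ _) ⟩
    defect X                                             ∎
    where open ≡-Reasoning

  nBd-fan : ∀ a → nBd (fan a) ≡ suc a
  nBd-fan zero = refl
  nBd-fan (suc a) = cong (λ n → suc (suc n)) (nBdL-leaves a)

  defect-fan : ∀ a → defect (fan a) ≡ + 0
  defect-fan zero = refl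
  defect-fan (suc a) = trans (ℤ.+-identityˡ _) (trans (ℤ.+-identityˡ _) (defectL-leaves a))

  nBd-cherry : ∀ a b → nBd (cherry a b) ≡ suc a + suc b
  nBd-cherry a b = cong₂ _+_ (nBd-fan a) (trans (ℕ.+-identityʳ _) (nBd-fan b))

  defect-cherry : ∀ a b → defect (cherry a b) ≡ + 1
  defect-cherry a b rewrite defect-fan a | defect-fan b = refl

  nBd-branch : ∀ L₁ a b L₂ → nBd (branch L₁ a b L₂) ≡ L₁ + ((suc a + suc b) + L₂)
  nBd-branch L₁ a b L₂ = trans (nBdL-around L₁ _ L₂) (cong (λ n → L₁ + (n + L₂)) (nBd-cherry a b))

  defect-branch : ∀ L₁ a b L₂ → defect (branch L₁ a b L₂) ≡ + 1
  defect-branch L₁ a b L₂ = trans (defectL-around L₁ _ L₂) (defect-cherry a b)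

  nBdL-pair : ∀ s x y → nBdL (pair s x y) ≡ nBd x + nBd y
  nBdL-pair left x y = cong (λ n → nBd x + n) (ℕ.+-identityʳ (nBd y))
  nBdL-pair right x y = trans (cong (λ n → nBd y + n) (ℕ.+-identityʳ (nBd x))) (ℕ.+-comm (nBd y) (nBd x))

  defectL-pair : ∀ s x y → defectL (pair s x y) ≡ defect x ℤ.+ defect y
  defectL-pair left x y = cong (λ d → defect x ℤ.+ d) (ℤ.+-identityʳ (defect y))
  defectL-pair right x y = trans (cong (λ d → defect y ℤ.+ d) (ℤ.+-identityʳ (defect x))) (ℤ.+-comm (defect y) (defect x))

  nBd-tripod : ∀ a b c → nBd (core (tripod a b c)) ≡ suc a + (suc b + suc c)
  nBd-tripod a b c = cong₂ _+_ (nBd-fan a) (cong₂ _+_ (nBd-fan b) (trans (ℕ.+-identityʳ _) (nBd-fan c)))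

  nBd-fork : ∀ s y L₁ z₁ z₂ L₂ → nBd (core (fork s y L₁ z₁ z₂ L₂)) ≡ suc y + (L₁ + ((suc z₁ + suc z₂) + L₂))
  nBd-fork s y L₁ z₁ z₂ L₂ = trans (nBdL-pair s _ _) (cong₂ _+_ (nBd-fan y) (nBd-branch L₁ z₁ z₂ L₂))

  defect-core : ∀ X → defect (core X) ≡ + 2
  defect-core (tripod a b c) rewrite defect-fan a | defect-fan b | defect-fan c = refl
  defect-core (fork left y L₁ z₁ z₂ L₂) =
    cong (λ d → + 1 ℤ.+ d) (trans (defectL-pair left (fan y) (branch L₁ z₁ z₂ L₂)) (cong₂ ℤ._+_ (defect-fan y) (defect-branch L₁ z₁ z₂ L₂)))
  defect-core (fork right y L₁ z₁ z₂ L₂) =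
    cong (λ d → + 1 ℤ.+ d) (trans (defectL-pair right (fan y) (branch L₁ z₁ z₂ L₂)) (cong₂ ℤ._+_ (defect-fan y) (defect-branch L₁ z₁ z₂ L₂)))

  nBd-shape : ∀ c → nBd (shape c) ≡ nBdL (rootChildren c)
  nBd-shape (one zero X zero) = sym (ℕ.+-identityʳ _)
  nBd-shape (one zero X (suc p)) = refl
  nBd-shape (one (suc q) X p) = refl
  nBd-shape (two q z₁ z₂ r y₁ y₂ p) = refl

  defect-shape : ∀ c → defect (shape c) ≡ + 2
  defect-shape (one zero X zero) = defect-core X
  defect-shape (one zero X (suc p)) = trans (defectL-around 0 (core X) (suc p)) (defect-core X)
  defect-shape (one (suc q) X p) = trans (defectL-around (suc q) (core X) p) (defect-core X)
  defect-shape (two q z₁ z₂ r y₁ y₂ p) = begin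
    defectL (leaves q ++ cherry z₁ z₂ ∷ around r (cherry y₁ y₂) p)
      ≡⟨ defectL-++ (leaves q) _ ⟩
    defectL (leaves q) ℤ.+ (defect (cherry z₁ z₂) ℤ.+ defectL (around r (cherry y₁ y₂) p))
      ≡⟨ cong₂ (λ d e → d ℤ.+ (defect (cherry z₁ z₂) ℤ.+ e)) (defectL-leaves q) (defectL-around r _ p) ⟩
    + 0 ℤ.+ (defect (cherry z₁ z₂) ℤ.+ defect (cherry y₁ y₂))
      ≡⟨ cong₂ (λ d e → + 0 ℤ.+ (d ℤ.+ e)) (defect-cherry z₁ z₂) (defect-cherry y₁ y₂) ⟩
    + 2 ∎
    where open ≡-Reasoning

  WFL-leaves : ∀ n → WFL (leaves n)
  WFL-leaves zero = tt
  WFL-leaves (suc n) = tt , WFL-leaves n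

  WFL-around : ∀ q {X} p → WF X → WFL (around q X p)
  WFL-around q p w = WFL-++⁺ (leaves q) (WFL-leaves q) (w , WFL-leaves p)

  WF-fan : ∀ a → WF (fan a)
  WF-fan zero = tt
  WF-fan (suc a) = tt , tt , WFL-leaves a

  WF-cherry : ∀ a b → WF (cherry a b)
  WF-cherry a b = WF-fan a , WF-fan b , tt

  WF-branch : ∀ L₁ a b L₂ → WF (branch L₁ a b L₂)
  WF-branch L₁ a b L₂ = WF-int⁺ white (leaves L₁) _ (leaves L₂) (WFL-around L₁ L₂ (WF-cherry a b))

  WF-core : ∀ X → WF (core X)
  WF-core (tripod a b c) = WF-fan a , WF-fan b , WF-fan c , tt
  WF-core (fork left y L₁ z₁ z₂ L₂) = WF-fan y , WF-branch L₁ z₁ z₂ L₂ , tt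
  WF-core (fork right y L₁ z₁ z₂ L₂) = WF-branch L₁ z₁ z₂ L₂ , WF-fan y , tt

  WF-shape : ∀ c → WF (shape c)
  WF-shape (one zero X zero) = WF-core X
  WF-shape (one zero X (suc p)) = WF-core X , WFL-leaves (suc p)
  WF-shape (one (suc q) X p) = tt , WFL-around q p (WF-core X)
  WF-shape (two q z₁ z₂ r y₁ y₂ p) =
    WF-int⁺ white (leaves q) _ _ (WFL-++⁺ (leaves q) (WFL-leaves q) (WF-cherry z₁ z₂ , WFL-around r p (WF-cherry y₁ y₂)))

  leaves-normal : ∀ c n → NormalChildren c (leaves n)
  leaves-normal black zero = []
  leaves-normal white zero = []
  leaves-normal black (suc n) = (tt , bd) ∷ leaves-normal black n
  leaves-normal white (suc n) = (tt , bd) ∷ leaves-normal white n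

  around-normal : ∀ c q {X} p → Unmergeable c X → Normal X → NormalChildren c (around q X p)
  around-normal c q p u n = ++⁺ (leaves-normal c q) ((u , n) ∷ leaves-normal c p)

  NotSingleton-around : ∀ q {X} p → 1 ≤ q + p → NotSingleton (around q X p)
  NotSingleton-around zero (suc p) _ = tt
  NotSingleton-around (suc zero) p _ = tt
  NotSingleton-around (suc (suc q)) p _ = tt

  NotSingleton-around⁻ : ∀ q {X} p → NotSingleton (around q X p) → 1 ≤ q + p
  NotSingleton-around⁻ zero (suc p) _ = s≤s z≤n
  NotSingleton-around⁻ (suc q) p _ = s≤s z≤n

  NotSingleton-∷++∷ : ∀ x xs y ys → NotSingleton (x ∷ xs ++ y ∷ ys)
  NotSingleton-∷++∷ x [] y ys = tt
  NotSingleton-∷++∷ x (_ ∷ _) y ys = tt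

  NotSingleton-++ : ∀ xs {y ys} → NotSingleton (y ∷ ys) → NotSingleton (xs ++ y ∷ ys)
  NotSingleton-++ [] n = n
  NotSingleton-++ (x ∷ xs) {y} {ys} _ = NotSingleton-∷++∷ x xs y ys

  fan-normal : ∀ a → Normal (fan a)
  fan-normal zero = bd
  fan-normal (suc a) = int tt (leaves-normal white (suc (suc a)))

  fan-unmergeable : ∀ a → Unmergeable black (fan a)
  fan-unmergeable zero = tt
  fan-unmergeable (suc a) = tt

  cherry-normal : ∀ a b → Normal (cherry a b)
  cherry-normal a b = int tt ((fan-unmergeable a , fan-normal a) ∷ (fan-unmergeable b , fan-normal b) ∷ [])

  branch-normal : ∀ L₁ a b L₂ → 1 ≤ L₁ + L₂ → Normal (branch L₁ a b L₂)
  branch-normal L₁ a b L₂ nonTrivial = int (NotSingleton-around L₁ L₂ nonTrivial) (around-normal white L₁ L₂ tt (cherry-normal a b))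

  pair-normal : ∀ s {x y} → Unmergeable black x × Normal x → Unmergeable black y × Normal y → NormalChildren black (pair s x y)
  pair-normal left nx ny = nx ∷ ny ∷ []
  pair-normal right nx ny = ny ∷ nx ∷ []

  tripod-normal : ∀ a b c → Normal (core (tripod a b c))
  tripod-normal a b c = int tt ((fan-unmergeable a , fan-normal a) ∷ (fan-unmergeable b , fan-normal b) ∷ (fan-unmergeable c , fan-normal c) ∷ [])

  fork-normal : ∀ s y L₁ z₁ z₂ L₂ → 1 ≤ L₁ + L₂ → Normal (core (fork s y L₁ z₁ z₂ L₂))
  fork-normal left y L₁ z₁ z₂ L₂ nonTrivial = int tt (pair-normal left (fan-unmergeable y , fan-normal y) (tt , branch-normal L₁ z₁ z₂ L₂ nonTrivial))
  fork-normal right y L₁ z₁ z₂ L₂ nonTrivial = int tt (pair-normal right (fan-unmergeable y , fan-normal y) (tt , branch-normal L₁ z₁ z₂ L₂ nonTrivial))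

  fork-normal⁻ : ∀ s y L₁ z₁ z₂ L₂ → Normal (core (fork s y L₁ z₁ z₂ L₂)) → 1 ≤ L₁ + L₂
  fork-normal⁻ left y L₁ z₁ z₂ L₂ (int _ (_ ∷ (_ , int notSingleton _) ∷ [])) = NotSingleton-around⁻ L₁ L₂ notSingleton
  fork-normal⁻ right y L₁ z₁ z₂ L₂ (int _ ((_ , int notSingleton _) ∷ _ ∷ [])) = NotSingleton-around⁻ L₁ L₂ notSingleton

  shape-one-normal : ∀ q X p → Normal (core X) → Normal (shape (one q X p))
  shape-one-normal zero X zero n = n
  shape-one-normal zero X (suc p) n = int tt (around-normal white 0 (suc p) tt n)
  shape-one-normal (suc q) X p n = int (NotSingleton-around (suc q) p (s≤s z≤n)) (around-normal white (suc q) p tt n)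

  shape-one-normal⁻ : ∀ q X p → Normal (shape (one q X p)) → Normal (core X)
  shape-one-normal⁻ zero X zero n = n
  shape-one-normal⁻ zero X (suc p) (int _ ((_ , n) ∷ _)) = n
  shape-one-normal⁻ (suc q) X p (int _ (_ ∷ ns)) = proj₂ (head (++⁻ʳ (leaves q) ns))
    where open import Data.List.Relation.Unary.All using (head)

  shape-two-normal : ∀ q z₁ z₂ r y₁ y₂ p → Normal (shape (two q z₁ z₂ r y₁ y₂ p))
  shape-two-normal q z₁ z₂ r y₁ y₂ p =
    int (NotSingleton-++ (leaves q) (NotSingleton-∷++∷ (cherry z₁ z₂) (leaves r) (cherry y₁ y₂) (leaves p))) (++⁺ (leaves-normal white q) ((tt , cherry-normal z₁ z₂) ∷ around-normal white r p tt (cherry-normal y₁ y₂)))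

  nBd-shape-one : ∀ q X p → nBd (shape (one q X p)) ≡ q + (nBd (core X) + p)
  nBd-shape-one q X p = trans (nBd-shape (one q X p)) (nBdL-around q (core X) p)

open Shapes

module Balance where
  open import Data.Nat using (ℕ; zero; suc; _+_; _*_; _∸_; _≤_; _<_; z≤n; s≤s)
  import Data.Nat.Properties as ℕ
  open import Data.Nat.Tactic.RingSolver using (solve)
  open import Data.Integer as ℤ using (ℤ; +_; +≤+)
  import Data.Integer.Properties as ℤ
  import Data.Integer.Tactic.RingSolver as ℤ-Solver
  open import Data.List using (List; []; _∷_; _++_; [_]; length; replicate)
  open import Data.List.Relation.Unary.All using (All; []; _∷_)
  open import Data.List.Relation.Unary.All.Properties using (++⁺; ++⁻ʳ)
  open import Data.Product using (Σ; ∃; ∃₂; _×_; _,_; proj₁; proj₂)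
  open import Data.Unit using (tt)
  open import Function using (_⇔_; mk⇔; Equivalence; _∋_)
  import Function.Properties.Equivalence
  open import Relation.Binary.PropositionalEquality hiding ([_])

  InRange⇔ : ∀ M n k → InRange M (+ n ℤ.- + k) ⇔ (k < n × n ≤ k + M)
  InRange⇔ M n k = mk⇔ to from
    where
    sub-add : ∀ x y → (x ℤ.- y) ℤ.+ y ≡ x
    sub-add = ℤ-Solver.solve-∀
    add-sub : ∀ x y → (x ℤ.+ y) ℤ.- x ≡ y
    add-sub = ℤ-Solver.solve-∀
    to : InRange M (+ n ℤ.- + k) → k < n × n ≤ k + M
    to (lo , hi) =
      ℤ.drop‿+≤+ (subst₂ ℤ._≤_ (sym (ℤ.pos-+ 1 k)) (sub-add (+ n) (+ k)) (ℤ.+-monoˡ-≤ (+ k) lo)) ,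
      subst (n ≤_) (ℕ.+-comm M k)
        (ℤ.drop‿+≤+ (subst₂ ℤ._≤_ (sub-add (+ n) (+ k)) (sym (ℤ.pos-+ M k)) (ℤ.+-monoˡ-≤ (+ k) hi)))
    from : k < n × n ≤ k + M → InRange M (+ n ℤ.- + k)
    from (k<n , n≤) =
      subst (ℤ._≤ + n ℤ.- + k) (trans (cong (ℤ._- + k) (ℤ.+-comm (+ 1) (+ k))) (add-sub (+ k) (+ 1)))
        (ℤ.+-monoˡ-≤ (ℤ.- + k) (subst (ℤ._≤ + n) (ℤ.pos-+ 1 k) (+≤+ k<n))) ,
      subst (+ n ℤ.- + k ℤ.≤_) (add-sub (+ k) (+ M))
        (ℤ.+-monoˡ-≤ (ℤ.- + k) (subst (+ n ℤ.≤_) (ℤ.pos-+ k M) (+≤+ n≤)))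

  EdgeBalanced⇔ : ∀ M S {n k} → nBd S ≡ n → + M ℤ.* defect S ≡ + k → EdgeBalanced M S ⇔ (k < n × n ≤ k + M)
  EdgeBalanced⇔ M S {n} {k} n≡ k≡ =
    subst (λ x → InRange M x ⇔ (k < n × n ≤ k + M)) (sym (cong₂ ℤ._-_ (cong +_ n≡) k≡)) (InRange⇔ M n k)

  trade : ∀ {a b x y t} → a + x ≡ t → b + y ≡ t → x ≤ y → b ≤ a
  trade {a} {b} {x} {y} eq₁ eq₂ x≤y = ℕ.+-cancelʳ-≤ x b a (subst (b + x ≤_) (trans eq₂ (sym eq₁)) (ℕ.+-monoʳ-≤ b x≤y))

  cancel⇔ : ∀ k {x y a b} → a ≡ k + x → b ≡ k + y → (a ≡ b) ⇔ (x ≡ y)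
  cancel⇔ k {x} {y} a≡ b≡ =
    mk⇔ (λ eq → ℕ.+-cancelˡ-≡ k x y (trans (sym a≡) (trans eq b≡))) (λ eq → trans a≡ (trans (cong (λ n → k + n) eq) (sym b≡)))

  CherryBounds : ℕ → ℕ → ℕ → Set
  CherryBounds m a b = a ≤ m × b ≤ m × m ≤ a + b

  Valid : ℕ → Code → Set
  Valid m (one q (tripod a b c) p) =
    (a ≤ m × b ≤ m × c ≤ m) × q + p ≤ m × q + p + (a + b + c) ≡ 3 * m
  Valid m (one q (fork _ y L₁ z₁ z₂ L₂) p) =
    y ≤ m × (CherryBounds m z₁ z₂ × L₁ + L₂ + (z₁ + z₂) ≤ 2 * m) × 1 ≤ L₁ + L₂ × q + p ≤ m
    × q + p + (y + (L₁ + L₂ + (z₁ + z₂))) ≡ 3 * m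
  Valid m (two q z₁ z₂ r y₁ y₂ p) =
    CherryBounds m z₁ z₂ × CherryBounds m y₁ y₂ × suc (q + r + p + (z₁ + z₂) + (y₁ + y₂)) ≡ 3 * m

  record AmplitreeNF (m : ℕ) (N : PT) : Set where
    field
      normal   : Normal N
      wf       : WF N
      defect≡  : defect N ≡ + 2
      nBd≡     : nBd N ≡ 3 * suc m
      balanced : Every (EdgeBalanced (suc m)) N

  module _ {m : ℕ} where
    private
      EB = EdgeBalanced (suc m)

    EB₀⇔ : ∀ S {n} → nBd S ≡ n → defect S ≡ + 0 → EB S ⇔ (0 < n × n ≤ suc m)
    EB₀⇔ S n≡ d≡ = EdgeBalanced⇔ (suc m) S n≡ (trans (cong (ℤ._*_ (+ suc m)) d≡) (ℤ.*-zeroʳ (+ suc m)))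

    EB₁⇔ : ∀ S {n} → nBd S ≡ n → defect S ≡ + 1 → EB S ⇔ (suc m < n × n ≤ suc m + suc m)
    EB₁⇔ S n≡ d≡ = EdgeBalanced⇔ (suc m) S n≡ (trans (cong (ℤ._*_ (+ suc m)) d≡) (ℤ.*-identityʳ (+ suc m)))

    EB₂⇔ : ∀ S {n} → nBd S ≡ n → defect S ≡ + 2 → EB S ⇔ (suc m + suc m < n × n ≤ suc m + suc m + suc m)
    EB₂⇔ S n≡ d≡ = EdgeBalanced⇔ (suc m) S n≡ (trans (cong (ℤ._*_ (+ suc m)) d≡) (trans (sym (ℤ.pos-* (suc m) 2)) (cong +_ twice)))
      where
      twice : suc m * 2 ≡ suc m + suc m
      twice = solve (List ℕ ∋ m ∷ [])

    EB-bd : EB bd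
    EB-bd = Equivalence.from (EB₀⇔ bd refl refl) (s≤s z≤n , s≤s z≤n)

    EveryL-leaves : ∀ n → EveryL EB (leaves n)
    EveryL-leaves zero = tt
    EveryL-leaves (suc n) = EB-bd , EveryL-leaves n

    EveryL-around⇔ : ∀ q X p → EveryL EB (around q X p) ⇔ Every EB X
    EveryL-around⇔ q X p = mk⇔
      (λ e → proj₁ (proj₂ (EveryL-++⁻ (leaves q) e)))
      (λ e → EveryL-++⁺ (leaves q) (EveryL-leaves q) (e , EveryL-leaves p))

    EveryL-pair⇔ : ∀ s x y → EveryL EB (pair s x y) ⇔ (Every EB x × Every EB y)
    EveryL-pair⇔ left x y = mk⇔ (λ (ex , ey , _) → ex , ey) (λ (ex , ey) → ex , ey , tt)
    EveryL-pair⇔ right x y = mk⇔ (λ (ey , ex , _) → ex , ey) (λ (ex , ey) → ey , ex , tt)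

    EB-fan⇔ : ∀ a → EB (fan a) ⇔ a ≤ m
    EB-fan⇔ a = Function.Properties.Equivalence.trans (EB₀⇔ (fan a) (nBd-fan a) (defect-fan a))
      (mk⇔ (λ (_ , a<1+m) → ℕ.≤-pred a<1+m) (λ a≤m → s≤s z≤n , s≤s a≤m))

    Every-fan : ∀ a → EB (fan a) → Every EB (fan a)
    Every-fan zero eb = eb
    Every-fan (suc a) eb = eb , EveryL-leaves (suc (suc a))

    Every-fan⇔ : ∀ a → Every EB (fan a) ⇔ a ≤ m
    Every-fan⇔ a = mk⇔ (λ e → Equivalence.to (EB-fan⇔ a) (Every-root (fan a) e))
                       (λ a≤m → Every-fan a (Equivalence.from (EB-fan⇔ a) a≤m))

    Every-cherry⇔ : ∀ a b → Every EB (cherry a b) ⇔ CherryBounds m a b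
    Every-cherry⇔ a b = mk⇔ to from
      where
      EB-cherry⇔ = EB₁⇔ (cherry a b) (nBd-cherry a b) (defect-cherry a b)
      to : Every EB (cherry a b) → CherryBounds m a b
      to (eb , ea , eb′ , _) =
        Equivalence.to (Every-fan⇔ a) ea , Equivalence.to (Every-fan⇔ b) eb′ ,
        ℕ.≤-pred (subst (suc m ≤_) (ℕ.+-suc a b) (ℕ.≤-pred (proj₁ (Equivalence.to EB-cherry⇔ eb))))
      from : CherryBounds m a b → Every EB (cherry a b)
      from (a≤m , b≤m , m≤a+b) =
        Equivalence.from EB-cherry⇔ (s≤s (subst (suc m ≤_) (sym (ℕ.+-suc a b)) (s≤s m≤a+b)) , ℕ.+-mono-≤ (s≤s a≤m) (s≤s b≤m)) ,
        Equivalence.from (Every-fan⇔ a) a≤m , Equivalence.from (Every-fan⇔ b) b≤m , tt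

    Every-branch⇔ : ∀ L₁ a b L₂ → Every EB (branch L₁ a b L₂) ⇔ (CherryBounds m a b × L₁ + L₂ + (a + b) ≤ 2 * m)
    Every-branch⇔ L₁ a b L₂ = mk⇔ to from
      where
      n≡ : L₁ + ((suc a + suc b) + L₂) ≡ 2 + (L₁ + L₂ + (a + b))
      n≡ = solve (List ℕ ∋ L₁ ∷ a ∷ b ∷ L₂ ∷ [])
      double≡ : (suc m) + (suc m) ≡ 2 + 2 * m
      double≡ = solve (List ℕ ∋ m ∷ [])
      EB-branch⇔ = EB₁⇔ (branch L₁ a b L₂) (trans (nBd-branch L₁ a b L₂) n≡) (defect-branch L₁ a b L₂)
      to : Every EB (branch L₁ a b L₂) → CherryBounds m a b × L₁ + L₂ + (a + b) ≤ 2 * m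
      to (eb , es) =
        Equivalence.to (Every-cherry⇔ a b) (Equivalence.to (EveryL-around⇔ L₁ (cherry a b) L₂) es) ,
        ℕ.≤-pred (ℕ.≤-pred (subst (2 + (L₁ + L₂ + (a + b)) ≤_) double≡ (proj₂ (Equivalence.to EB-branch⇔ eb))))
      from : CherryBounds m a b × L₁ + L₂ + (a + b) ≤ 2 * m → Every EB (branch L₁ a b L₂)
      from (bounds@(_ , _ , m≤a+b) , L≤) =
        Equivalence.from EB-branch⇔ (s≤s (s≤s (ℕ.≤-trans m≤a+b (ℕ.m≤n+m (a + b) (L₁ + L₂)))) , subst (2 + (L₁ + L₂ + (a + b)) ≤_) (sym double≡) (s≤s (s≤s L≤))) ,
        Equivalence.from (EveryL-around⇔ L₁ (cherry a b) L₂) (Equivalence.from (Every-cherry⇔ a b) bounds)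

    EB-core⇔ : ∀ q X p → q + (nBd (core X) + p) ≡ 3 * suc m → EB (core X) ⇔ q + p ≤ m
    EB-core⇔ q X p total = mk⇔ to from
      where
      N = nBd (core X)
      EB-core = EB₂⇔ (core X) refl (defect-core X)
      rearrange : ∀ n → n + (q + p) ≡ q + (n + p)
      rearrange n = solve (List ℕ ∋ n ∷ q ∷ p ∷ [])
      total′ : N + (q + p) ≡ 3 * suc m
      total′ = trans (rearrange N) total
      threeM : m + suc (suc m + suc m) ≡ 3 * suc m
      threeM = solve (List ℕ ∋ m ∷ [])
      threeM′ : 3 * suc m ≡ (suc m + suc m) + suc m
      threeM′ = solve (List ℕ ∋ m ∷ [])
      to : EB (core X) → q + p ≤ m
      to eb = trade threeM (trans (ℕ.+-comm (q + p) N) total′) (proj₁ (Equivalence.to EB-core eb))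
      from : q + p ≤ m → EB (core X)
      from q+p≤m = Equivalence.from EB-core
        ( trade total′ (trans (ℕ.+-comm (suc (suc m + suc m)) m) threeM) q+p≤m
        , ℕ.≤-trans (ℕ.m≤m+n N (q + p)) (ℕ.≤-reflexive (trans total′ threeM′)) )

    EB-root : ∀ N → nBd N ≡ 3 * (suc m) → defect N ≡ + 2 → EB N
    EB-root N total defect≡ = Equivalence.from (EB₂⇔ N total defect≡)
      (subst (suc m + suc m <_) (sym threeM) (s≤s (ℕ.m≤m+n (suc m + suc m) m)) , ℕ.≤-reflexive threeM′)
      where
      threeM : 3 * suc m ≡ suc (suc m + suc m + m)
      threeM = solve (List ℕ ∋ m ∷ [])
      threeM′ : 3 * suc m ≡ (suc m + suc m) + suc m
      threeM′ = solve (List ℕ ∋ m ∷ [])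

    Every-white⇔ : ∀ L → nBd (int white L) ≡ 3 * suc m → defect (int white L) ≡ + 2 → Every EB (int white L) ⇔ EveryL EB L
    Every-white⇔ L total defect≡ = mk⇔ proj₂ (λ e → EB-root (int white L) total defect≡ , e)

    Every-shape-one⇔ : ∀ q X p → nBd (shape (one q X p)) ≡ 3 * suc m → Every EB (shape (one q X p)) ⇔ Every EB (core X)
    Every-shape-one⇔ zero X zero _ = mk⇔ (λ e → e) (λ e → e)
    Every-shape-one⇔ zero X (suc p) total =
      Function.Properties.Equivalence.trans (Every-white⇔ (around 0 (core X) (suc p)) total (defect-shape (one 0 X (suc p)))) (EveryL-around⇔ 0 (core X) (suc p))
    Every-shape-one⇔ (suc q) X p total =
      Function.Properties.Equivalence.trans (Every-white⇔ (around (suc q) (core X) p) total (defect-shape (one (suc q) X p))) (EveryL-around⇔ (suc q) (core X) p)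

    Every-shape-two⇔ : ∀ q z₁ z₂ r y₁ y₂ p → nBd (shape (two q z₁ z₂ r y₁ y₂ p)) ≡ 3 * suc m →
      Every EB (shape (two q z₁ z₂ r y₁ y₂ p)) ⇔ (CherryBounds m z₁ z₂ × CherryBounds m y₁ y₂)
    Every-shape-two⇔ q z₁ z₂ r y₁ y₂ p total = Function.Properties.Equivalence.trans
      (Every-white⇔ (rootChildren (two q z₁ z₂ r y₁ y₂ p)) total (defect-shape (two q z₁ z₂ r y₁ y₂ p))) (mk⇔ to from)
      where
      to : EveryL EB (leaves q ++ cherry z₁ z₂ ∷ around r (cherry y₁ y₂) p) → CherryBounds m z₁ z₂ × CherryBounds m y₁ y₂
      to e = let (_ , ez , rest) = EveryL-++⁻ (leaves q) e in
        Equivalence.to (Every-cherry⇔ z₁ z₂) ez ,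
        Equivalence.to (Every-cherry⇔ y₁ y₂) (Equivalence.to (EveryL-around⇔ r (cherry y₁ y₂) p) rest)
      from : CherryBounds m z₁ z₂ × CherryBounds m y₁ y₂ → EveryL EB (leaves q ++ cherry z₁ z₂ ∷ around r (cherry y₁ y₂) p)
      from (bz , by) = EveryL-++⁺ (leaves q) (EveryL-leaves q)
        (Equivalence.from (Every-cherry⇔ z₁ z₂) bz , Equivalence.from (EveryL-around⇔ r (cherry y₁ y₂) p) (Equivalence.from (Every-cherry⇔ y₁ y₂) by))

    three-suc : 3 * suc m ≡ 3 + 3 * m
    three-suc = solve (List ℕ ∋ m ∷ [])

    tripod⇔ : ∀ q a b c p → AmplitreeNF m (shape (one q (tripod a b c) p)) ⇔ Valid m (one q (tripod a b c) p)
    tripod⇔ q a b c p = mk⇔ to from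
      where
      X = tripod a b c
      total⇔ : (q + (nBd (core X) + p) ≡ 3 * suc m) ⇔ (q + p + (a + b + c) ≡ 3 * m)
      total⇔ = cancel⇔ 3 {q + p + (a + b + c)} (trans (cong (λ n → q + (n + p)) (nBd-tripod a b c)) (solve (List ℕ ∋ q ∷ a ∷ b ∷ c ∷ p ∷ []))) three-suc
      to : AmplitreeNF m (shape (one q X p)) → Valid m (one q X p)
      to nf =
        (Equivalence.to (Every-fan⇔ a) ea , Equivalence.to (Every-fan⇔ b) eb , Equivalence.to (Every-fan⇔ c) ec) ,
        Equivalence.to (EB-core⇔ q X p total) eX , Equivalence.to total⇔ total
        where
        open AmplitreeNF nf
        total = trans (sym (nBd-shape-one q X p)) nBd≡
        every = Equivalence.to (Every-shape-one⇔ q X p nBd≡) balanced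
        eX = proj₁ every
        ea = proj₁ (proj₂ every)
        eb = proj₁ (proj₂ (proj₂ every))
        ec = proj₁ (proj₂ (proj₂ (proj₂ every)))
      from : Valid m (one q X p) → AmplitreeNF m (shape (one q X p))
      from ((a≤m , b≤m , c≤m) , q+p≤m , tot) = record
        { normal = shape-one-normal q X p (tripod-normal a b c)
        ; wf = WF-shape (one q X p)
        ; defect≡ = defect-shape (one q X p)
        ; nBd≡ = nBd≡
        ; balanced = Equivalence.from (Every-shape-one⇔ q X p nBd≡)
            ( Equivalence.from (EB-core⇔ q X p total) q+p≤m
            , Equivalence.from (Every-fan⇔ a) a≤m , Equivalence.from (Every-fan⇔ b) b≤m , Equivalence.from (Every-fan⇔ c) c≤m , tt )
        }
        where
        total = Equivalence.from total⇔ tot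
        nBd≡ = trans (nBd-shape-one q X p) total

    fork⇔ : ∀ q s y L₁ z₁ z₂ L₂ p → AmplitreeNF m (shape (one q (fork s y L₁ z₁ z₂ L₂) p)) ⇔ Valid m (one q (fork s y L₁ z₁ z₂ L₂) p)
    fork⇔ q s y L₁ z₁ z₂ L₂ p = mk⇔ to from
      where
      X = fork s y L₁ z₁ z₂ L₂
      total⇔ : (q + (nBd (core X) + p) ≡ 3 * suc m) ⇔ (q + p + (y + (L₁ + L₂ + (z₁ + z₂))) ≡ 3 * m)
      total⇔ = cancel⇔ 3 {q + p + (y + (L₁ + L₂ + (z₁ + z₂)))}
        (trans (cong (λ n → q + (n + p)) (nBd-fork s y L₁ z₁ z₂ L₂)) (solve (List ℕ ∋ q ∷ y ∷ L₁ ∷ z₁ ∷ z₂ ∷ L₂ ∷ p ∷ [])))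
        three-suc
      to : AmplitreeNF m (shape (one q X p)) → Valid m (one q X p)
      to nf =
        Equivalence.to (Every-fan⇔ y) (proj₁ kids) , Equivalence.to (Every-branch⇔ L₁ z₁ z₂ L₂) (proj₂ kids) ,
        fork-normal⁻ s y L₁ z₁ z₂ L₂ (shape-one-normal⁻ q X p normal) ,
        Equivalence.to (EB-core⇔ q X p total) (proj₁ every) , Equivalence.to total⇔ total
        where
        open AmplitreeNF nf
        total = trans (sym (nBd-shape-one q X p)) nBd≡
        every = Equivalence.to (Every-shape-one⇔ q X p nBd≡) balanced
        kids = Equivalence.to (EveryL-pair⇔ s (fan y) (branch L₁ z₁ z₂ L₂)) (proj₂ every)
      from : Valid m (one q X p) → AmplitreeNF m (shape (one q X p))
      from (y≤m , branch-bounds , nonTrivial , q+p≤m , tot) = record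
        { normal = shape-one-normal q X p (fork-normal s y L₁ z₁ z₂ L₂ nonTrivial)
        ; wf = WF-shape (one q X p)
        ; defect≡ = defect-shape (one q X p)
        ; nBd≡ = nBd≡
        ; balanced = Equivalence.from (Every-shape-one⇔ q X p nBd≡)
            ( Equivalence.from (EB-core⇔ q X p total) q+p≤m
            , Equivalence.from (EveryL-pair⇔ s (fan y) (branch L₁ z₁ z₂ L₂))
                (Equivalence.from (Every-fan⇔ y) y≤m , Equivalence.from (Every-branch⇔ L₁ z₁ z₂ L₂) branch-bounds) )
        }
        where
        total = Equivalence.from total⇔ tot
        nBd≡ = trans (nBd-shape-one q X p) total

    two⇔ : ∀ q z₁ z₂ r y₁ y₂ p → AmplitreeNF m (shape (two q z₁ z₂ r y₁ y₂ p)) ⇔ Valid m (two q z₁ z₂ r y₁ y₂ p)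
    two⇔ q z₁ z₂ r y₁ y₂ p = mk⇔ to from
      where
      c = two q z₁ z₂ r y₁ y₂ p
      nBd≡′ : nBd (shape c) ≡ 4 + (q + r + p + (z₁ + z₂) + (y₁ + y₂))
      nBd≡′ = begin
        nBdL (leaves q ++ cherry z₁ z₂ ∷ around r (cherry y₁ y₂) p)
          ≡⟨ nBdL-++ (leaves q) _ ⟩
        nBdL (leaves q) + (nBd (cherry z₁ z₂) + nBdL (around r (cherry y₁ y₂) p))
          ≡⟨ cong₂ (λ n k → n + (nBd (cherry z₁ z₂) + k)) (nBdL-leaves q) (nBdL-around r _ p) ⟩
        q + (nBd (cherry z₁ z₂) + (r + (nBd (cherry y₁ y₂) + p)))
          ≡⟨ cong₂ (λ n k → q + (n + (r + (k + p)))) (nBd-cherry z₁ z₂) (nBd-cherry y₁ y₂) ⟩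
        q + ((suc z₁ + suc z₂) + (r + ((suc y₁ + suc y₂) + p)))
          ≡⟨ solve (List ℕ ∋ q ∷ z₁ ∷ z₂ ∷ r ∷ y₁ ∷ y₂ ∷ p ∷ []) ⟩
        4 + (q + r + p + (z₁ + z₂) + (y₁ + y₂)) ∎
        where open ≡-Reasoning
      total⇔ : (nBd (shape c) ≡ 3 * suc m) ⇔ (suc (q + r + p + (z₁ + z₂) + (y₁ + y₂)) ≡ 3 * m)
      total⇔ = cancel⇔ 3 nBd≡′ three-suc
      to : AmplitreeNF m (shape c) → Valid m c
      to nf = let (bz , by) = Equivalence.to (Every-shape-two⇔ q z₁ z₂ r y₁ y₂ p nBd≡) balanced
              in bz , by , Equivalence.to total⇔ nBd≡
        where open AmplitreeNF nf
      from : Valid m c → AmplitreeNF m (shape c)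
      from (bz , by , tot) = record
        { normal = shape-two-normal q z₁ z₂ r y₁ y₂ p
        ; wf = WF-shape c
        ; defect≡ = defect-shape c
        ; nBd≡ = Equivalence.from total⇔ tot
        ; balanced = Equivalence.from (Every-shape-two⇔ q z₁ z₂ r y₁ y₂ p (Equivalence.from total⇔ tot)) (bz , by)
        }

    valid⇔ : ∀ c → AmplitreeNF m (shape c) ⇔ Valid m c
    valid⇔ (one q (tripod a b c) p) = tripod⇔ q a b c p
    valid⇔ (one q (fork s y L₁ z₁ z₂ L₂) p) = fork⇔ q s y L₁ z₁ z₂ L₂ p
    valid⇔ (two q z₁ z₂ r y₁ y₂ p) = two⇔ q z₁ z₂ r y₁ y₂ p

open Balance

module Enumerations where
  open import Data.Nat using (ℕ; zero; suc; _+_; _*_; _∸_; _≤_; _<_; z≤n; s≤s)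
  import Data.Nat.Properties as ℕ
  open import Data.Fin using (Fin; toℕ; fromℕ<; splitAt; join; _↑ˡ_; _↑ʳ_; combine; remQuot)
  import Data.Fin.Properties as Fin
  open import Data.Product using (Σ; ∃; _×_; _,_; proj₁; proj₂; uncurry)
  open import Data.Sum using (_⊎_; inj₁; inj₂; [_,_])
  open import Data.Empty using (⊥; ⊥-elim)
  open import Relation.Nullary using (¬_)
  open import Relation.Binary.PropositionalEquality hiding ([_])

  record Enumeration {A : Set} (P : A → Set) (n : ℕ) : Set where
    field
      elem      : Fin n → A
      sound     : ∀ i → P (elem i)
      injective : ∀ {i j} → elem i ≡ elem j → i ≡ j
      complete  : ∀ {a} → P a → ∃ λ i → elem i ≡ a

  open Enumeration

  below : ∀ n → Enumeration (_< n) n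
  below n = record
    { elem = toℕ
    ; sound = Fin.toℕ<n
    ; injective = Fin.toℕ-injective
    ; complete = λ k<n → fromℕ< k<n , Fin.toℕ-fromℕ< k<n
    }

  module _ {A B : Set} {P : A → Set} {Q : B → Set} {n : ℕ} where
    image : (f : A → B) → (∀ a → P a → Q (f a)) → (∀ {a a′} → P a → P a′ → f a ≡ f a′ → a ≡ a′) →
      (∀ b → Q b → ∃ λ a → P a × f a ≡ b) → Enumeration P n → Enumeration Q n
    image f f-sound f-injective f-onto E = record
      { elem = λ i → f (E .elem i)
      ; sound = λ i → f-sound _ (E .sound i)
      ; injective = λ {i} {j} eq → E .injective (f-injective (E .sound i) (E .sound j) eq)
      ; complete = λ {b} q → let (a , p , fa≡b) = f-onto b q ; (i , eq) = E .complete p in i , trans (cong f eq) fa≡b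
      }

    transport : (f : A → B) (g : B → A) →
      (∀ a → P a → Q (f a)) → (∀ a → P a → g (f a) ≡ a) →
      (∀ b → Q b → P (g b)) → (∀ b → Q b → f (g b) ≡ b) →
      Enumeration P n → Enumeration Q n
    transport f g f-sound g∘f g-sound f∘g = image f f-sound
      (λ {a} {a′} p p′ eq → trans (sym (g∘f a p)) (trans (cong g eq) (g∘f a′ p′)))
      (λ b q → g b , g-sound b q , f∘g b q)

  module _ {A : Set} {P Q : A → Set} {n k : ℕ} where
    union : Enumeration P n → Enumeration Q k → (∀ {a} → P a → ¬ Q a) → Enumeration (λ a → P a ⊎ Q a) (n + k)
    union E F disjoint = record
      { elem = λ i → pick (splitAt n i)
      ; sound = λ i → pick-sound (splitAt n i)
      ; injective = λ {i} {j} eq → begin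
          i                     ≡⟨ Fin.join-splitAt n k i ⟨
          join n k (splitAt n i) ≡⟨ cong (join n k) (pick-injective (splitAt n i) (splitAt n j) eq) ⟩
          join n k (splitAt n j) ≡⟨ Fin.join-splitAt n k j ⟩
          j                     ∎
      ; complete = pick-complete
      }
      where
      open ≡-Reasoning
      pick : Fin n ⊎ Fin k → A
      pick = [ E .elem , F .elem ]
      pick-sound : ∀ s → P (pick s) ⊎ Q (pick s)
      pick-sound (inj₁ i) = inj₁ (E .sound i)
      pick-sound (inj₂ j) = inj₂ (F .sound j)
      pick-injective : ∀ s t → pick s ≡ pick t → s ≡ t
      pick-injective (inj₁ i) (inj₁ i′) eq = cong inj₁ (E .injective eq)
      pick-injective (inj₂ j) (inj₂ j′) eq = cong inj₂ (F .injective eq)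
      pick-injective (inj₁ i) (inj₂ j) eq = ⊥-elim (disjoint (E .sound i) (subst Q (sym eq) (F .sound j)))
      pick-injective (inj₂ j) (inj₁ i) eq = ⊥-elim (disjoint (E .sound i) (subst Q eq (F .sound j)))
      pick-complete : ∀ {a} → P a ⊎ Q a → ∃ λ i → pick (splitAt n i) ≡ a
      pick-complete (inj₁ p) = let (i , eq) = E .complete p in i ↑ˡ k , trans (cong pick (Fin.splitAt-↑ˡ n i k)) eq
      pick-complete (inj₂ q) = let (j , eq) = F .complete q in n ↑ʳ j , trans (cong pick (Fin.splitAt-↑ʳ n k j)) eq

  empty : ∀ {A : Set} {P : A → Set} → (∀ {a} → ¬ P a) → Enumeration P 0
  empty none = record { elem = λ () ; sound = λ () ; injective = λ {i} → ⊥-elim (Fin.¬Fin0 i) ; complete = λ p → ⊥-elim (none p) }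

  module _ {A B : Set} {P : A → Set} {Q : B → Set} {n k : ℕ} where
    infixr 2 _⊗_
    _⊗_ : Enumeration P n → Enumeration Q k → Enumeration (λ (a , b) → P a × Q b) (n * k)
    E ⊗ F = record
      { elem = λ i → elems (remQuot {n} k i)
      ; sound = λ i → E .sound (proj₁ (remQuot {n} k i)) , F .sound (proj₂ (remQuot {n} k i))
      ; injective = λ {i} {j} eq → begin
          i                              ≡⟨ Fin.combine-remQuot {n} k i ⟨
          uncurry combine (remQuot {n} k i) ≡⟨ cong (uncurry combine) (elems-injective (remQuot {n} k i) (remQuot {n} k j) eq) ⟩
          uncurry combine (remQuot {n} k j) ≡⟨ Fin.combine-remQuot {n} k j ⟩
          j                              ∎
      ; complete = λ (p , q) → let (i , eq₁) = E .complete p ; (j , eq₂) = F .complete q in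
          combine i j , trans (cong elems (Fin.remQuot-combine i j)) (cong₂ _,_ eq₁ eq₂)
      }
      where
      open ≡-Reasoning
      elems : Fin n × Fin k → A × B
      elems (i , j) = E .elem i , F .elem j
      elems-injective : ∀ s t → elems s ≡ elems t → s ≡ t
      elems-injective (i , j) (i′ , j′) eq = cong₂ _,_ (E .injective (cong proj₁ eq)) (F .injective (cong proj₂ eq))

  ∑< : ℕ → (ℕ → ℕ) → ℕ
  ∑< zero f = 0
  ∑< (suc n) f = ∑< n f + f n

  syntax ∑< n (λ i → e) = ∑[ i < n ] e

  module _ {B : Set} (Q : ℕ → B → Set) where
    Below : ℕ → ℕ × B → Set
    Below n (i , b) = i < n × Q i b

    At : ℕ → ℕ × B → Set
    At n (i , b) = i ≡ n × Q i b

    private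
      widen : ∀ {n x} → Below n x ⊎ At n x → Below (suc n) x
      widen (inj₁ (i<n , q)) = ℕ.m<n⇒m<1+n i<n , q
      widen {n} (inj₂ (refl , q)) = ℕ.n<1+n n , q

      narrow : ∀ {n x} → Below (suc n) x → Below n x ⊎ At n x
      narrow (i<1+n , q) with ℕ.m≤n⇒m<n∨m≡n (ℕ.≤-pred i<1+n)
      ... | inj₁ i<n = inj₁ (i<n , q)
      ... | inj₂ i≡n = inj₂ (i≡n , q)

      disjoint : ∀ {n x} → Below n x → ¬ At n x
      disjoint (i<n , _) (refl , _) = ℕ.<-irrefl refl i<n

      at : ∀ {n k} → Enumeration (Q n) k → Enumeration (At n) k
      at {n} = transport (n ,_) proj₂ (λ _ q → refl , q) (λ _ _ → refl) (λ { _ (refl , q) → q }) (λ { _ (refl , _) → refl })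

    Σ-below : ∀ {f : ℕ → ℕ} n → (∀ i → Enumeration (Q i) (f i)) → Enumeration (Below n) (∑[ i < n ] f i)
    Σ-below zero F = empty (λ ())
    Σ-below (suc n) F = transport (λ x → x) (λ x → x) (λ _ → widen) (λ _ _ → refl) (λ _ → narrow) (λ _ _ → refl)
      (union (Σ-below n F) (at (F n)) disjoint)

  Composition₂ : ℕ → ℕ × ℕ → Set
  Composition₂ s (x , y) = x + y ≡ s

  compositions₂ : ∀ s → Enumeration (Composition₂ s) (suc s)
  compositions₂ s = transport (λ x → x , s ∸ x) proj₁
    (λ _ x<1+s → ℕ.m+[n∸m]≡n (ℕ.≤-pred x<1+s)) (λ _ _ → refl)
    (λ (x , y) x+y≡s → s≤s (subst (x ≤_) x+y≡s (ℕ.m≤m+n x y)))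
    (λ (x , y) x+y≡s → cong (x ,_) (trans (cong (_∸ x) (sym x+y≡s)) (ℕ.m+n∸m≡n x y)))
    (below (suc s))

  Composition₃ : ℕ → ℕ × ℕ × ℕ → Set
  Composition₃ s (x , y , z) = x + y + z ≡ s

  triangle : ℕ → ℕ
  triangle s = ∑[ t < suc s ] suc t

  compositions₃ : ∀ s → Enumeration (Composition₃ s) (triangle s)
  compositions₃ s = transport split merge split-sound merge∘split merge-sound split∘merge (Σ-below Composition₂ (suc s) compositions₂)
    where
    split : ℕ × ℕ × ℕ → ℕ × ℕ × ℕ
    split (t , y , z) = s ∸ t , y , z
    merge : ℕ × ℕ × ℕ → ℕ × ℕ × ℕ
    merge (x , y , z) = y + z , y , z
    split-sound : ∀ w → Below Composition₂ (suc s) w → Composition₃ s (split w)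
    split-sound (t , y , z) (t<1+s , refl) = trans (ℕ.+-assoc (s ∸ t) y z) (ℕ.m∸n+n≡m (ℕ.≤-pred t<1+s))
    merge∘split : ∀ w → Below Composition₂ (suc s) w → merge (split w) ≡ w
    merge∘split (t , y , z) (_ , refl) = refl
    merge-sound : ∀ w → Composition₃ s w → Below Composition₂ (suc s) (merge w)
    merge-sound (x , y , z) refl = s≤s (subst (y + z ≤_) (sym (ℕ.+-assoc x y z)) (ℕ.m≤n+m (y + z) x)) , refl
    split∘merge : ∀ w → Composition₃ s w → split (merge w) ≡ w
    split∘merge (x , y , z) refl = cong (_, y , z) (trans (cong (_∸ (y + z)) (ℕ.+-assoc x y z)) (ℕ.m+n∸n≡m x (y + z)))

open Enumerations

module Families where
  open import Data.Nat using (ℕ; zero; suc; _+_; _*_; _∸_; _≤_; _<_; z≤n; s≤s)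
  import Data.Nat.Properties as ℕ
  open import Data.Nat.Tactic.RingSolver using (solve)
  open import Data.List using (List; []; _∷_)
  open import Data.Product using (Σ; ∃; _×_; _,_; proj₁; proj₂)
  open import Data.Empty using (⊥)
  open import Data.Sum using (_⊎_; inj₁; inj₂; [_,_]′)
  open import Relation.Nullary using (¬_)
  open import Function using (_∋_)
  open import Relation.Binary.PropositionalEquality

  complement-pair : ∀ {m x y} → x ≤ m → y ≤ m → ((m ∸ x) + (m ∸ y)) + (x + y) ≡ m + m
  complement-pair {m} {x} {y} x≤m y≤m = trans (regroup (m ∸ x) (m ∸ y)) (cong₂ _+_ (ℕ.m∸n+n≡m x≤m) (ℕ.m∸n+n≡m y≤m))
    where
    regroup : ∀ A B → (A + B) + (x + y) ≡ (A + x) + (B + y)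
    regroup A B = solve (List ℕ ∋ A ∷ B ∷ x ∷ y ∷ [])

  summands≤ : ∀ x y {m} → x + y ≤ m → x ≤ m × y ≤ m
  summands≤ x y x+y≤m = ℕ.≤-trans (ℕ.m≤m+n x y) x+y≤m , ℕ.≤-trans (ℕ.m≤n+m y x) x+y≤m

  cherry-of-deficits : ∀ x y {m} → x + y ≤ m → CherryBounds m (m ∸ x) (m ∸ y)
  cherry-of-deficits x y {m} x+y≤m =
    ℕ.m∸n≤m m x , ℕ.m∸n≤m m y , trade (complement-pair x≤m y≤m) refl x+y≤m
    where
    x≤m = proj₁ (summands≤ x y x+y≤m)
    y≤m = proj₂ (summands≤ x y x+y≤m)

  deficits-of-cherry : ∀ {m a b} → CherryBounds m a b → (m ∸ a) + (m ∸ b) ≤ m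
  deficits-of-cherry (a≤m , b≤m , m≤a+b) = trade refl (complement-pair a≤m b≤m) m≤a+b

  module _ (m : ℕ) where

    TripodIndex : ℕ × (ℕ × ℕ × ℕ) × (ℕ × ℕ) → Set
    TripodIndex = Below (λ s (a′b′c′ , qp) → Composition₃ s a′b′c′ × Composition₂ s qp) (suc m)

    tripods : ℕ
    tripods = ∑[ s < suc m ] (triangle s * suc s)

    ValidTripod : Code → Set
    ValidTripod c@(one _ (tripod _ _ _) _) = Valid m c
    ValidTripod _ = ⊥

    tripodCodes : Enumeration ValidTripod tripods
    tripodCodes = transport encode decode encode-valid decode∘encode decode-valid encode∘decode
      (Σ-below _ (suc m) (λ s → compositions₃ s ⊗ compositions₂ s))
      where
      encode : ℕ × (ℕ × ℕ × ℕ) × (ℕ × ℕ) → Code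
      encode (_ , (a′ , b′ , c′) , (q , p)) = one q (tripod (m ∸ a′) (m ∸ b′) (m ∸ c′)) p
      decode : Code → ℕ × (ℕ × ℕ × ℕ) × (ℕ × ℕ)
      decode (one q (tripod a b c) p) = q + p , (m ∸ a , m ∸ b , m ∸ c) , (q , p)
      decode _ = 0 , (0 , 0 , 0) , (0 , 0)
      regroup : ∀ x y z A B C → (x + y + z) + (A + B + C) ≡ (A + x) + ((B + y) + (C + z))
      regroup x y z A B C = solve (List ℕ ∋ x ∷ y ∷ z ∷ A ∷ B ∷ C ∷ [])
      three : m + (m + m) ≡ 3 * m
      three = solve (List ℕ ∋ m ∷ [])
      total : ∀ {x y z} → x ≤ m → y ≤ m → z ≤ m → (x + y + z) + ((m ∸ x) + (m ∸ y) + (m ∸ z)) ≡ 3 * m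
      total {x} {y} {z} x≤m y≤m z≤m = trans (regroup x y z (m ∸ x) (m ∸ y) (m ∸ z)) (trans (cong₂ _+_ (ℕ.m∸n+n≡m x≤m) (cong₂ _+_ (ℕ.m∸n+n≡m y≤m) (ℕ.m∸n+n≡m z≤m))) three)
      parts≤ : ∀ x y z → x + y + z ≤ m → x ≤ m × y ≤ m × z ≤ m
      parts≤ x y z sum≤m = let (x+y≤m , z≤m) = summands≤ (x + y) z sum≤m ; (x≤m , y≤m) = summands≤ x y x+y≤m in x≤m , y≤m , z≤m
      encode-valid : ∀ x → TripodIndex x → ValidTripod (encode x)
      encode-valid (_ , (a′ , b′ , c′) , (q , p)) (s<1+m , refl , qp≡s) =
        (ℕ.m∸n≤m m a′ , ℕ.m∸n≤m m b′ , ℕ.m∸n≤m m c′) , subst (_≤ m) (sym qp≡s) (ℕ.≤-pred s<1+m) ,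
        trans (cong (_+ ((m ∸ a′) + (m ∸ b′) + (m ∸ c′))) qp≡s) (total a′≤m b′≤m c′≤m)
        where
        a′≤m = proj₁ (parts≤ a′ b′ c′ (ℕ.≤-pred s<1+m))
        b′≤m = proj₁ (proj₂ (parts≤ a′ b′ c′ (ℕ.≤-pred s<1+m)))
        c′≤m = proj₂ (proj₂ (parts≤ a′ b′ c′ (ℕ.≤-pred s<1+m)))
      decode∘encode : ∀ x → TripodIndex x → decode (encode x) ≡ x
      decode∘encode (_ , (a′ , b′ , c′) , (q , p)) (s<1+m , refl , qp≡s)
        with parts≤ a′ b′ c′ (ℕ.≤-pred s<1+m)
      ... | a′≤m , b′≤m , c′≤m rewrite ℕ.m∸[m∸n]≡n a′≤m | ℕ.m∸[m∸n]≡n b′≤m | ℕ.m∸[m∸n]≡n c′≤m | qp≡s = refl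
      decode-valid : ∀ c → ValidTripod c → TripodIndex (decode c)
      decode-valid (one q (tripod a b c) p) ((a≤m , b≤m , c≤m) , qp≤m , qp-total) =
        s≤s qp≤m ,
        ℕ.+-cancelʳ-≡ (a + b + c) _ _ (trans (ℕ.+-comm _ (a + b + c)) (trans (total a≤m b≤m c≤m) (sym qp-total))) ,
        refl
      encode∘decode : ∀ c → ValidTripod c → encode (decode c) ≡ c
      encode∘decode (one q (tripod a b c) p) ((a≤m , b≤m , c≤m) , _)
        rewrite ℕ.m∸[m∸n]≡n a≤m | ℕ.m∸[m∸n]≡n b≤m | ℕ.m∸[m∸n]≡n c≤m = refl

    ForkIndex : ℕ × (ℕ × ℕ) × ℕ × (ℕ × ℕ) × ℕ × (ℕ × ℕ) → Set
    ForkIndex = Below (λ Z (z′ , rest) → Composition₂ Z z′ ×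
                  Below (λ w (L , rest′) → Composition₂ (Z ∸ w) L ×
                    Below (λ y′ qp → Composition₂ (y′ + w) qp) (suc m ∸ w) rest′) Z rest) (suc m)

    forks : ℕ
    forks = ∑[ Z < suc m ] (suc Z * ∑[ w < Z ] (suc (Z ∸ w) * ∑[ y′ < suc m ∸ w ] suc (y′ + w)))

    ValidFork : Side → Code → Set
    ValidFork s c@(one _ (fork s′ _ _ _ _ _) _) = s ≡ s′ × Valid m c
    ValidFork s _ = ⊥

    forkCodes : ∀ s → Enumeration (ValidFork s) forks
    forkCodes s = transport encode decode encode-valid decode∘encode decode-valid encode∘decode
      (Σ-below _ (suc m) λ Z → compositions₂ Z ⊗ Σ-below _ Z λ w → compositions₂ (Z ∸ w) ⊗ Σ-below _ (suc m ∸ w) λ y′ → compositions₂ (y′ + w))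
      where
      encode : ℕ × (ℕ × ℕ) × ℕ × (ℕ × ℕ) × ℕ × (ℕ × ℕ) → Code
      encode (_ , (z₁′ , z₂′) , _ , (L₁ , L₂) , y′ , (q , p)) = one q (fork s (m ∸ y′) L₁ (m ∸ z₁′) (m ∸ z₂′) L₂) p
      decode : Code → ℕ × (ℕ × ℕ) × ℕ × (ℕ × ℕ) × ℕ × (ℕ × ℕ)
      decode (one q (fork _ y L₁ z₁ z₂ L₂) p) =
        let Z = (m ∸ z₁) + (m ∸ z₂) in Z , (m ∸ z₁ , m ∸ z₂) , Z ∸ (L₁ + L₂) , (L₁ , L₂) , m ∸ y , (q , p)
      decode _ = 0 , (0 , 0) , 0 , (0 , 0) , 0 , (0 , 0)
      index-bounds : ∀ z₁′ z₂′ w y′ → z₁′ + z₂′ < suc m → w < z₁′ + z₂′ → y′ < suc m ∸ w → z₁′ ≤ m × z₂′ ≤ m × y′ + w ≤ m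
      index-bounds z₁′ z₂′ w y′ Z<1+m w<Z y′<m+1∸w =
        proj₁ (summands≤ z₁′ z₂′ (ℕ.≤-pred Z<1+m)) , proj₂ (summands≤ z₁′ z₂′ (ℕ.≤-pred Z<1+m)) ,
        ℕ.≤-pred (subst (suc y′ + w ≤_) (ℕ.m∸n+n≡m w≤1+m) (ℕ.+-monoˡ-≤ w y′<m+1∸w))
        where w≤1+m = ℕ.≤-trans (ℕ.<⇒≤ w<Z) (ℕ.<⇒≤ Z<1+m)
      encode-valid : ∀ x → ForkIndex x → ValidFork s (encode x)
      encode-valid (_ , (z₁′ , z₂′) , w , (L₁ , L₂) , y′ , (q , p)) (Z<1+m , refl , w<Z , L≡ , y′<m+1∸w , qp≡) =
        refl , ℕ.m∸n≤m m y′ , (cherry-of-deficits z₁′ z₂′ Z≤m , L+A≤2m) , subst (0 <_) (sym L≡) (ℕ.m<n⇒0<n∸m w<Z) ,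
        subst (_≤ m) (sym qp≡) y′+w≤m , total
        where
        Z≤m = ℕ.≤-pred Z<1+m
        bounds = index-bounds z₁′ z₂′ w y′ Z<1+m w<Z y′<m+1∸w
        z₁′≤m = proj₁ bounds
        z₂′≤m = proj₁ (proj₂ bounds)
        y′+w≤m = proj₂ (proj₂ bounds)
        A = (m ∸ z₁′) + (m ∸ z₂′)
        L+w : L₁ + L₂ + w ≡ z₁′ + z₂′
        L+w = trans (cong (_+ w) L≡) (ℕ.m∸n+n≡m (ℕ.<⇒≤ w<Z))
        A+Z : A + (z₁′ + z₂′) ≡ m + m
        A+Z = complement-pair z₁′≤m z₂′≤m
        L+A≤2m : L₁ + L₂ + A ≤ 2 * m
        L+A≤2m = subst (L₁ + L₂ + A ≤_) (trans (rearrange (L₁ + L₂) A) (trans (cong (λ n → A + n) L+w) (trans A+Z (solve (List ℕ ∋ m ∷ [])))))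
                   (ℕ.m≤m+n (L₁ + L₂ + A) w)
          where
          rearrange : ∀ L A → L + A + w ≡ A + (L + w)
          rearrange L A = solve (List ℕ ∋ L ∷ A ∷ w ∷ [])
        total : q + p + ((m ∸ y′) + (L₁ + L₂ + A)) ≡ 3 * m
        total = begin
          q + p + ((m ∸ y′) + (L₁ + L₂ + A))    ≡⟨ cong (_+ ((m ∸ y′) + (L₁ + L₂ + A))) qp≡ ⟩
          y′ + w + ((m ∸ y′) + (L₁ + L₂ + A))   ≡⟨ regroup (m ∸ y′) (L₁ + L₂) A ⟩
          ((m ∸ y′) + y′) + (A + (L₁ + L₂ + w)) ≡⟨ cong₂ (λ a b → a + (A + b)) (ℕ.m∸n+n≡m y′≤m) L+w ⟩
          m + (A + (z₁′ + z₂′))                 ≡⟨ cong (λ n → m + n) A+Z ⟩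
          m + (m + m)                           ≡⟨ solve (List ℕ ∋ m ∷ []) ⟩
          3 * m                                 ∎
          where
          open ≡-Reasoning
          y′≤m = ℕ.≤-trans (ℕ.m≤m+n y′ w) y′+w≤m
          regroup : ∀ Y L A → y′ + w + (Y + (L + A)) ≡ (Y + y′) + (A + (L + w))
          regroup Y L A = solve (List ℕ ∋ y′ ∷ w ∷ Y ∷ L ∷ A ∷ [])
      decode∘encode : ∀ x → ForkIndex x → decode (encode x) ≡ x
      decode∘encode (_ , (z₁′ , z₂′) , w , (L₁ , L₂) , y′ , (q , p)) (Z<1+m , refl , w<Z , L≡ , y′<m+1∸w , _)
        with index-bounds z₁′ z₂′ w y′ Z<1+m w<Z y′<m+1∸w
      ... | z₁′≤m , z₂′≤m , y′+w≤m
        rewrite ℕ.m∸[m∸n]≡n z₁′≤m | ℕ.m∸[m∸n]≡n z₂′≤m | ℕ.m∸[m∸n]≡n (ℕ.≤-trans (ℕ.m≤m+n y′ w) y′+w≤m)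
              | L≡ | ℕ.m∸[m∸n]≡n (ℕ.<⇒≤ w<Z) = refl
      decode-valid : ∀ c → ValidFork s c → ForkIndex (decode c)
      decode-valid (one q (fork _ y L₁ z₁ z₂ L₂) p) (refl , y≤m , (cherry@(z₁≤m , z₂≤m , _) , L+z≤2m) , 0<L , q+p≤m , q+p-total) =
        s≤s (deficits-of-cherry cherry) , refl , ℕ.∸-monoʳ-< 0<L L≤A , sym (ℕ.m∸[m∸n]≡n L≤A) ,
        ℕ.m+n≤o⇒m≤o∸n (suc (m ∸ y)) (s≤s (subst (_≤ m) key q+p≤m)) , key
        where
        A = (m ∸ z₁) + (m ∸ z₂)
        L = L₁ + L₂
        A+z : A + (z₁ + z₂) ≡ m + m
        A+z = complement-pair z₁≤m z₂≤m
        L≤A : L ≤ A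
        L≤A = ℕ.+-cancelʳ-≤ (z₁ + z₂) L A (subst (L + (z₁ + z₂) ≤_) (trans twice (sym A+z)) L+z≤2m)
          where
          twice : 2 * m ≡ m + m
          twice = solve (List ℕ ∋ m ∷ [])
        key : q + p ≡ (m ∸ y) + (A ∸ L)
        key = ℕ.+-cancelʳ-≡ (y + (L + (z₁ + z₂))) (q + p) ((m ∸ y) + (A ∸ L)) (trans q+p-total (sym (begin
          (m ∸ y) + (A ∸ L) + (y + (L + (z₁ + z₂)))   ≡⟨ regroup (m ∸ y) (A ∸ L) L ⟩
          ((m ∸ y) + y) + ((A ∸ L) + L + (z₁ + z₂))   ≡⟨ cong₂ (λ a b → a + (b + (z₁ + z₂))) (ℕ.m∸n+n≡m y≤m) (ℕ.m∸n+n≡m L≤A) ⟩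
          m + (A + (z₁ + z₂))                         ≡⟨ cong (λ n → m + n) A+z ⟩
          m + (m + m)                                 ≡⟨ solve (List ℕ ∋ m ∷ []) ⟩
          3 * m                                       ∎)))
          where
          open ≡-Reasoning
          regroup : ∀ Y w L → Y + w + (y + (L + (z₁ + z₂))) ≡ (Y + y) + (w + L + (z₁ + z₂))
          regroup Y w L = solve (List ℕ ∋ Y ∷ w ∷ y ∷ L ∷ z₁ ∷ z₂ ∷ [])
      encode∘decode : ∀ c → ValidFork s c → encode (decode c) ≡ c
      encode∘decode (one q (fork _ y L₁ z₁ z₂ L₂) p) (refl , y≤m , ((z₁≤m , z₂≤m , _) , _) , _)
        rewrite ℕ.m∸[m∸n]≡n y≤m | ℕ.m∸[m∸n]≡n z₁≤m | ℕ.m∸[m∸n]≡n z₂≤m = refl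

    TwoIndex : ℕ × (ℕ × ℕ) × ℕ × (ℕ × ℕ) × (ℕ × ℕ × ℕ) → Set
    TwoIndex = Below (λ Z (z′ , rest) → Composition₂ Z z′ ×
                 Below (λ u (y′ , qrp) → Composition₂ (suc m ∸ Z + u) y′ × Composition₃ u qrp) Z rest) (suc m)

    twos : ℕ
    twos = ∑[ Z < suc m ] (suc Z * ∑[ u < Z ] (suc (suc m ∸ Z + u) * triangle u))

    ValidTwo : Code → Set
    ValidTwo c@(two _ _ _ _ _ _ _) = Valid m c
    ValidTwo _ = ⊥

    twoCodes : Enumeration ValidTwo twos
    twoCodes = transport encode decode encode-valid decode∘encode decode-valid encode∘decode
      (Σ-below _ (suc m) λ Z → compositions₂ Z ⊗ Σ-below _ Z λ u → compositions₂ (suc m ∸ Z + u) ⊗ compositions₃ u)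
      where
      encode : ℕ × (ℕ × ℕ) × ℕ × (ℕ × ℕ) × (ℕ × ℕ × ℕ) → Code
      encode (_ , (z₁′ , z₂′) , _ , (y₁′ , y₂′) , (q , r , p)) = two q (m ∸ z₁′) (m ∸ z₂′) r (m ∸ y₁′) (m ∸ y₂′) p
      decode : Code → ℕ × (ℕ × ℕ) × ℕ × (ℕ × ℕ) × (ℕ × ℕ × ℕ)
      decode (two q z₁ z₂ r y₁ y₂ p) = (m ∸ z₁) + (m ∸ z₂) , (m ∸ z₁ , m ∸ z₂) , q + r + p , (m ∸ y₁ , m ∸ y₂) , (q , r , p)
      decode _ = 0 , (0 , 0) , 0 , (0 , 0) , (0 , 0 , 0)
      Y≤m : ∀ Z u → Z ≤ suc m → u < Z → suc m ∸ Z + u ≤ m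
      Y≤m Z u Z≤1+m u<Z = ℕ.≤-pred (subst₂ _≤_ (ℕ.+-suc (suc m ∸ Z) u) (ℕ.m∸n+n≡m Z≤1+m) (ℕ.+-monoʳ-≤ (suc m ∸ Z) u<Z))
      encode-valid : ∀ x → TwoIndex x → ValidTwo (encode x)
      encode-valid (_ , (z₁′ , z₂′) , _ , (y₁′ , y₂′) , (q , r , p)) (Z<1+m , refl , u<Z , Y≡ , refl) =
        cherry-of-deficits z₁′ z₂′ Z≤m , cherry-of-deficits y₁′ y₂′ Y≤m′ , total
        where
        Z = z₁′ + z₂′
        u = q + r + p
        Y = y₁′ + y₂′
        A = (m ∸ z₁′) + (m ∸ z₂′)
        B = (m ∸ y₁′) + (m ∸ y₂′)
        Z≤m = ℕ.≤-pred Z<1+m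
        Y≤m′ : Y ≤ m
        Y≤m′ = subst (_≤ m) (sym Y≡) (Y≤m Z u (ℕ.<⇒≤ Z<1+m) u<Z)
        four-m : ∀ {k} → suc (u + A + B) + (Z + Y) ≡ k → 3 * m + (Z + Y) ≡ k → suc (u + A + B) ≡ 3 * m
        four-m eq₁ eq₂ = ℕ.+-cancelʳ-≡ (Z + Y) _ _ (trans eq₁ (sym eq₂))
        total : suc (u + A + B) ≡ 3 * m
        total = four-m {suc u + ((m + m) + (m + m))}
          (trans (regroup u A B Z Y)
            (cong₂ (λ a b → suc u + (a + b)) (complement-pair (proj₁ (summands≤ z₁′ z₂′ Z≤m)) (proj₂ (summands≤ z₁′ z₂′ Z≤m)))
                                             (complement-pair (proj₁ (summands≤ y₁′ y₂′ Y≤m′)) (proj₂ (summands≤ y₁′ y₂′ Y≤m′)))))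
          (trans (cong (λ n → 3 * m + (Z + n)) Y≡)
            (trans (regroup′ (suc m ∸ Z) Z u) (trans (cong (λ n → 3 * m + (n + u)) (ℕ.m∸n+n≡m (ℕ.<⇒≤ Z<1+m))) (final u))))
          where
          regroup : ∀ u A B Z Y → suc (u + A + B) + (Z + Y) ≡ suc u + ((A + Z) + (B + Y))
          regroup u A B Z Y = solve (List ℕ ∋ u ∷ A ∷ B ∷ Z ∷ Y ∷ [])
          regroup′ : ∀ D Z u → 3 * m + (Z + (D + u)) ≡ 3 * m + (D + Z + u)
          regroup′ D Z u = solve (List ℕ ∋ m ∷ D ∷ Z ∷ u ∷ [])
          final : ∀ u → 3 * m + (suc m + u) ≡ suc u + ((m + m) + (m + m))
          final u = solve (List ℕ ∋ m ∷ u ∷ [])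
      decode∘encode : ∀ x → TwoIndex x → decode (encode x) ≡ x
      decode∘encode (_ , (z₁′ , z₂′) , _ , (y₁′ , y₂′) , (q , r , p)) (Z<1+m , refl , u<Z , Y≡ , refl)
        with summands≤ z₁′ z₂′ (ℕ.≤-pred Z<1+m)
           | summands≤ y₁′ y₂′ (subst (_≤ m) (sym Y≡) (Y≤m (z₁′ + z₂′) (q + r + p) (ℕ.<⇒≤ Z<1+m) u<Z))
      ... | z₁′≤m , z₂′≤m | y₁′≤m , y₂′≤m
        rewrite ℕ.m∸[m∸n]≡n z₁′≤m | ℕ.m∸[m∸n]≡n z₂′≤m | ℕ.m∸[m∸n]≡n y₁′≤m | ℕ.m∸[m∸n]≡n y₂′≤m = refl
      decode-valid : ∀ c → ValidTwo c → TwoIndex (decode c)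
      decode-valid (two q z₁ z₂ r y₁ y₂ p) (cz@(z₁≤m , z₂≤m , _) , cy@(y₁≤m , y₂≤m , _) , q+r+p-total) =
        s≤s A≤m , refl , trade (trans (ℕ.+-comm A B) key) (cong suc (ℕ.+-comm u m)) (deficits-of-cherry cy) , B≡ , refl
        where
        u = q + r + p
        A = (m ∸ z₁) + (m ∸ z₂)
        B = (m ∸ y₁) + (m ∸ y₂)
        A≤m = deficits-of-cherry cz
        key : B + A ≡ suc m + u
        key = ℕ.+-cancelʳ-≡ ((z₁ + z₂) + (y₁ + y₂)) (B + A) (suc m + u) (begin
          B + A + ((z₁ + z₂) + (y₁ + y₂))       ≡⟨ regroup B A (z₁ + z₂) (y₁ + y₂) ⟩
          (B + (y₁ + y₂)) + (A + (z₁ + z₂))     ≡⟨ cong₂ _+_ (complement-pair y₁≤m y₂≤m) (complement-pair z₁≤m z₂≤m) ⟩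
          (m + m) + (m + m)                     ≡⟨ solve (List ℕ ∋ m ∷ []) ⟩
          m + 3 * m                             ≡⟨ cong (λ n → m + n) q+r+p-total ⟨
          m + suc (u + (z₁ + z₂) + (y₁ + y₂))   ≡⟨ regroup′ u (z₁ + z₂) (y₁ + y₂) ⟩
          suc m + u + ((z₁ + z₂) + (y₁ + y₂))   ∎)
          where
          open ≡-Reasoning
          regroup : ∀ B A z y → B + A + (z + y) ≡ (B + y) + (A + z)
          regroup B A z y = solve (List ℕ ∋ B ∷ A ∷ z ∷ y ∷ [])
          regroup′ : ∀ u z y → m + suc (u + z + y) ≡ suc m + u + (z + y)
          regroup′ u z y = solve (List ℕ ∋ m ∷ u ∷ z ∷ y ∷ [])
        B≡ : B ≡ suc m ∸ A + u
        B≡ = begin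
          B                 ≡⟨ ℕ.m+n∸n≡m B A ⟨
          B + A ∸ A         ≡⟨ cong (_∸ A) key ⟩
          suc m + u ∸ A     ≡⟨ ℕ.+-∸-comm u (ℕ.m≤n⇒m≤1+n A≤m) ⟩
          suc m ∸ A + u     ∎
          where open ≡-Reasoning
      encode∘decode : ∀ c → ValidTwo c → encode (decode c) ≡ c
      encode∘decode (two q z₁ z₂ r y₁ y₂ p) ((z₁≤m , z₂≤m , _) , (y₁≤m , y₂≤m , _) , _)
        rewrite ℕ.m∸[m∸n]≡n z₁≤m | ℕ.m∸[m∸n]≡n z₂≤m | ℕ.m∸[m∸n]≡n y₁≤m | ℕ.m∸[m∸n]≡n y₂≤m = refl

    count : ℕ
    count = tripods + (forks + (forks + twos))

    validCodes : Enumeration (Valid m) count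
    validCodes = transport (λ c → c) (λ c → c) (λ c → from-family c) (λ _ _ → refl) (λ c → to-family c) (λ _ _ → refl)
      (union tripodCodes (union (forkCodes left) (union (forkCodes right) twoCodes right∩two) left∩rest) tripod∩rest)
      where
      Family : Code → Set
      Family c = ValidTripod c ⊎ (ValidFork left c ⊎ (ValidFork right c ⊎ ValidTwo c))
      tripod-valid : ∀ c → ValidTripod c → Valid m c
      tripod-valid (one _ (tripod _ _ _) _) v = v
      fork-valid : ∀ s c → ValidFork s c → Valid m c
      fork-valid s (one _ (fork _ _ _ _ _ _) _) (_ , v) = v
      two-valid : ∀ c → ValidTwo c → Valid m c
      two-valid (two _ _ _ _ _ _ _) v = v
      from-family : ∀ c → Family c → Valid m c
      from-family c = [ tripod-valid c , [ fork-valid left c , [ fork-valid right c , two-valid c ]′ ]′ ]′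
      to-family : ∀ c → Valid m c → Family c
      to-family (one q (tripod a b c) p) v = inj₁ v
      to-family (one q (fork left y L₁ z₁ z₂ L₂) p) v = inj₂ (inj₁ (refl , v))
      to-family (one q (fork right y L₁ z₁ z₂ L₂) p) v = inj₂ (inj₂ (inj₁ (refl , v)))
      to-family (two q z₁ z₂ r y₁ y₂ p) v = inj₂ (inj₂ (inj₂ v))
      right∩two : ∀ {c} → ValidFork right c → ¬ ValidTwo c
      right∩two {one _ (fork _ _ _ _ _ _) _} _ ()
      left∩rest : ∀ {c} → ValidFork left c → ¬ (ValidFork right c ⊎ ValidTwo c)
      left∩rest {one _ (fork _ _ _ _ _ _) _} (refl , _) (inj₁ (() , _))
      tripod∩rest : ∀ {c} → ValidTripod c → ¬ (ValidFork left c ⊎ (ValidFork right c ⊎ ValidTwo c))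
      tripod∩rest {one _ (tripod _ _ _) _} _ (inj₁ ())
      tripod∩rest {one _ (tripod _ _ _) _} _ (inj₂ (inj₁ ()))

open Families

module Counting where
  open import Data.Bool.Properties using (T-≡)
  open import Function using (Equivalence)
  open import Data.Nat.Combinatorics using (_C_)
  open import Data.Nat as ℕ using (ℕ; zero; suc; _<_; _≤_; s≤s; z≤n)
  import Data.Nat.Properties as ℕ
  open import Data.Integer using (ℤ; +_; -_; _+_; _-_; _*_)
  import Data.Integer.Properties as ℤ
  open import Data.Integer.Tactic.RingSolver using (solve-∀)
  open import Relation.Binary.PropositionalEquality

  pos-suc : ∀ n → + suc n ≡ + n + + 1
  pos-suc n = trans (cong +_ (ℕ.+-comm 1 n)) (ℤ.pos-+ n 1)

  pos-∸ : ∀ {m n} → n ≤ m → + (m ℕ.∸ n) ≡ + m - + n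
  pos-∸ {m} {n} n≤m = sym (trans (ℤ.m-n≡m⊖n m n) (ℤ.⊖-≥ n≤m))

  telescope : ∀ (k : ℤ) (f : ℕ → ℕ) (F : ℤ → ℤ) n → F (+ 0) ≡ + 0 →
    (∀ i → i < n → F (+ i) + k * + f i ≡ F (+ i + + 1)) → k * + ∑< n f ≡ F (+ n)
  telescope k f F zero F0 step = trans (ℤ.*-zeroʳ k) (sym F0)
  telescope k f F (suc n) F0 step = begin
    k * + (∑< n f ℕ.+ f n)        ≡⟨ cong (k *_) (ℤ.pos-+ (∑< n f) (f n)) ⟩
    k * (+ ∑< n f + + f n)        ≡⟨ ℤ.*-distribˡ-+ k (+ ∑< n f) (+ f n) ⟩
    k * + ∑< n f + k * + f n      ≡⟨ cong (_+ k * + f n) (telescope k f F n F0 (λ i i<n → step i (ℕ.m<n⇒m<1+n i<n))) ⟩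
    F (+ n) + k * + f n           ≡⟨ step n (ℕ.n<1+n n) ⟩
    F (+ n + + 1)                 ≡⟨ cong F (pos-suc n) ⟨
    F (+ suc n)                   ∎
    where open ≡-Reasoning

  triangle-closed : ∀ s → + 2 * + triangle s ≡ (+ s + + 1) * (+ s + + 2)
  triangle-closed s = trans (telescope (+ 2) suc (λ x → x * (x + + 1)) (suc s) refl step)
    (trans (cong (λ x → x * (x + + 1)) (pos-suc s)) (shift (+ s)))
    where
    identity : ∀ x → x * (x + + 1) + + 2 * (x + + 1) ≡ (x + + 1) * ((x + + 1) + + 1)
    identity = solve-∀
    shift : ∀ x → (x + + 1) * ((x + + 1) + + 1) ≡ (x + + 1) * (x + + 2)
    shift = solve-∀
    step : ∀ i → i < suc s → (+ i) * (+ i + + 1) + + 2 * + suc i ≡ (+ i + + 1) * ((+ i + + 1) + + 1)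
    step i _ = trans (cong (λ y → (+ i) * (+ i + + 1) + + 2 * y) (pos-suc i)) (identity (+ i))

  P-tripods : ℤ → ℤ
  P-tripods x = x * (x + + 1) * (x + + 2) * (+ 3 * x + + 1)

  tripods-closed : ∀ m → + 24 * + tripods m ≡ P-tripods (+ suc m)
  tripods-closed m = telescope (+ 24) (λ s → triangle s ℕ.* suc s) P-tripods (suc m) refl step
    where
    identity : ∀ x → x * (x + + 1) * (x + + 2) * (+ 3 * x + + 1) + + 12 * ((x + + 1) * (x + + 2)) * (x + + 1)
                   ≡ (x + + 1) * ((x + + 1) + + 1) * ((x + + 1) + + 2) * (+ 3 * (x + + 1) + + 1)
    identity = solve-∀
    regroup : ∀ t s → + 24 * (t * s) ≡ + 12 * (+ 2 * t) * s
    regroup = solve-∀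
    step : ∀ s → s < suc m → P-tripods (+ s) + + 24 * + (triangle s ℕ.* suc s) ≡ P-tripods (+ s + + 1)
    step s _ = begin
      P-tripods (+ s) + + 24 * + (triangle s ℕ.* suc s)
        ≡⟨ cong (λ y → P-tripods (+ s) + + 24 * y) (ℤ.pos-* (triangle s) (suc s)) ⟩
      P-tripods (+ s) + + 24 * (+ triangle s * + suc s)
        ≡⟨ cong (λ y → P-tripods (+ s) + y) (regroup (+ triangle s) (+ suc s)) ⟩
      P-tripods (+ s) + + 12 * (+ 2 * + triangle s) * + suc s
        ≡⟨ cong₂ (λ t u → P-tripods (+ s) + + 12 * t * u) (triangle-closed s) (pos-suc s) ⟩
      P-tripods (+ s) + + 12 * ((+ s + + 1) * (+ s + + 2)) * (+ s + + 1)
        ≡⟨ identity (+ s) ⟩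
      P-tripods (+ s + + 1) ∎
      where open ≡-Reasoning

  forks₃-closed : ∀ M w → w ≤ M → + 2 * + ∑< (M ℕ.∸ w) (λ y → suc (y ℕ.+ w)) ≡ (+ M - + w) * (+ M + + w + + 1)
  forks₃-closed M w w≤M = begin
    + 2 * + ∑< (M ℕ.∸ w) (λ y → suc (y ℕ.+ w))
      ≡⟨ telescope (+ 2) (λ y → suc (y ℕ.+ w)) (λ x → x * (x + + 2 * + w + + 1)) (M ℕ.∸ w) refl step ⟩
    + (M ℕ.∸ w) * (+ (M ℕ.∸ w) + + 2 * + w + + 1)
      ≡⟨ cong (λ d → d * (d + + 2 * + w + + 1)) (pos-∸ w≤M) ⟩
    (+ M - + w) * ((+ M - + w) + + 2 * + w + + 1)
      ≡⟨ simplify (+ M) (+ w) ⟩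
    (+ M - + w) * (+ M + + w + + 1) ∎
    where
    open ≡-Reasoning
    simplify : ∀ M w → (M - w) * ((M - w) + + 2 * w + + 1) ≡ (M - w) * (M + w + + 1)
    simplify = solve-∀
    identity : ∀ x w → x * (x + + 2 * w + + 1) + + 2 * (x + w + + 1) ≡ (x + + 1) * ((x + + 1) + + 2 * w + + 1)
    identity = solve-∀
    step : ∀ y → y < M ℕ.∸ w → + y * (+ y + + 2 * + w + + 1) + + 2 * + suc (y ℕ.+ w) ≡ (+ y + + 1) * ((+ y + + 1) + + 2 * + w + + 1)
    step y _ = trans (cong (λ t → + y * (+ y + + 2 * + w + + 1) + + 2 * t) (trans (pos-suc (y ℕ.+ w)) (cong (_+ + 1) (ℤ.pos-+ y w))))
                     (identity (+ y) (+ w))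

  P-forks₂ : ℤ → ℤ → ℤ → ℤ
  P-forks₂ x M Z = x * (+ 6 * M * (M + + 1) * (+ 2 * Z - x + + 3) + (x - + 1) * (x + + 1) * (+ 3 * x - + 4 * Z - + 6))

  forks₂-closed : ∀ M Z → Z ≤ M →
    + 24 * + ∑< Z (λ w → suc (Z ℕ.∸ w) ℕ.* ∑< (M ℕ.∸ w) (λ y → suc (y ℕ.+ w))) ≡ P-forks₂ (+ Z) (+ M) (+ Z)
  forks₂-closed M Z Z≤M = telescope (+ 24) _ (λ x → P-forks₂ x (+ M) (+ Z)) Z refl step
    where
    identity : ∀ x M Z →
      x * (+ 6 * M * (M + + 1) * (+ 2 * Z - x + + 3) + (x - + 1) * (x + + 1) * (+ 3 * x - + 4 * Z - + 6))
        + + 12 * (Z - x + + 1) * ((M - x) * (M + x + + 1))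
      ≡ (x + + 1) * (+ 6 * M * (M + + 1) * (+ 2 * Z - (x + + 1) + + 3)
                     + ((x + + 1) - + 1) * ((x + + 1) + + 1) * (+ 3 * (x + + 1) - + 4 * Z - + 6))
    identity = solve-∀
    regroup : ∀ a g → + 24 * (a * g) ≡ + 12 * a * (+ 2 * g)
    regroup = solve-∀
    step : ∀ w → w < Z →
      P-forks₂ (+ w) (+ M) (+ Z) + + 24 * + (suc (Z ℕ.∸ w) ℕ.* ∑< (M ℕ.∸ w) (λ y → suc (y ℕ.+ w))) ≡ P-forks₂ (+ w + + 1) (+ M) (+ Z)
    step w w<Z = begin
      P-forks₂ (+ w) (+ M) (+ Z) + + 24 * + (suc (Z ℕ.∸ w) ℕ.* G)
        ≡⟨ cong (λ t → P-forks₂ (+ w) (+ M) (+ Z) + t)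
             (trans (cong (+ 24 *_) (ℤ.pos-* (suc (Z ℕ.∸ w)) G)) (regroup (+ suc (Z ℕ.∸ w)) (+ G))) ⟩
      P-forks₂ (+ w) (+ M) (+ Z) + + 12 * + suc (Z ℕ.∸ w) * (+ 2 * + G)
        ≡⟨ cong₂ (λ a g → P-forks₂ (+ w) (+ M) (+ Z) + + 12 * a * g)
             (trans (pos-suc (Z ℕ.∸ w)) (cong (_+ + 1) (pos-∸ (ℕ.<⇒≤ w<Z))))
             (forks₃-closed M w (ℕ.≤-trans (ℕ.<⇒≤ w<Z) Z≤M)) ⟩
      P-forks₂ (+ w) (+ M) (+ Z) + + 12 * (+ Z - + w + + 1) * ((+ M - + w) * (+ M + + w + + 1))
        ≡⟨ identity (+ w) (+ M) (+ Z) ⟩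
      P-forks₂ (+ w + + 1) (+ M) (+ Z) ∎
      where
      open ≡-Reasoning
      G = ∑< (M ℕ.∸ w) (λ y → suc (y ℕ.+ w))

  P-forks : ℤ → ℤ → ℤ
  P-forks x M = x * (+ 15 * M * (M + + 1) * (x - + 1) * (x + + 1) * (+ 3 * x + + 10)
                     - (x - + 1) * (x + + 1) * (x - + 2) * (+ 5 * x * x + + 37 * x + + 24))

  forks-closed : ∀ m → + 720 * + forks m ≡ P-forks (+ suc m) (+ suc m)
  forks-closed m = telescope (+ 720) (λ Z → suc Z ℕ.* ∑< Z (λ w → suc (Z ℕ.∸ w) ℕ.* ∑< (M ℕ.∸ w) (λ y → suc (y ℕ.+ w))))
    (λ x → P-forks x (+ M)) M refl step
    where
    M = suc m
    identity : ∀ x M →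
      x * (+ 15 * M * (M + + 1) * (x - + 1) * (x + + 1) * (+ 3 * x + + 10)
           - (x - + 1) * (x + + 1) * (x - + 2) * (+ 5 * x * x + + 37 * x + + 24))
        + + 30 * (x + + 1) * (x * (+ 6 * M * (M + + 1) * (+ 2 * x - x + + 3) + (x - + 1) * (x + + 1) * (+ 3 * x - + 4 * x - + 6)))
      ≡ (x + + 1) * (+ 15 * M * (M + + 1) * ((x + + 1) - + 1) * ((x + + 1) + + 1) * (+ 3 * (x + + 1) + + 10)
                     - ((x + + 1) - + 1) * ((x + + 1) + + 1) * ((x + + 1) - + 2) * (+ 5 * (x + + 1) * (x + + 1) + + 37 * (x + + 1) + + 24))
    identity = solve-∀
    regroup : ∀ a h → + 720 * (a * h) ≡ + 30 * a * (+ 24 * h)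
    regroup = solve-∀
    step : ∀ Z → Z < M → P-forks (+ Z) (+ M) + + 720 * + (suc Z ℕ.* ∑< Z (λ w → suc (Z ℕ.∸ w) ℕ.* ∑< (M ℕ.∸ w) (λ y → suc (y ℕ.+ w))))
                       ≡ P-forks (+ Z + + 1) (+ M)
    step Z Z<M = begin
      P-forks (+ Z) (+ M) + + 720 * + (suc Z ℕ.* H)
        ≡⟨ cong (λ t → P-forks (+ Z) (+ M) + t) (trans (cong (+ 720 *_) (ℤ.pos-* (suc Z) H)) (regroup (+ suc Z) (+ H))) ⟩
      P-forks (+ Z) (+ M) + + 30 * + suc Z * (+ 24 * + H)
        ≡⟨ cong₂ (λ a h → P-forks (+ Z) (+ M) + + 30 * a * h) (pos-suc Z) (forks₂-closed M Z (ℕ.<⇒≤ Z<M)) ⟩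
      P-forks (+ Z) (+ M) + + 30 * (+ Z + + 1) * P-forks₂ (+ Z) (+ M) (+ Z)
        ≡⟨ identity (+ Z) (+ M) ⟩
      P-forks (+ Z + + 1) (+ M) ∎
      where
      open ≡-Reasoning
      H = ∑< Z (λ w → suc (Z ℕ.∸ w) ℕ.* ∑< (M ℕ.∸ w) (λ y → suc (y ℕ.+ w)))

  P-twos₂ : ℤ → ℤ → ℤ → ℤ
  P-twos₂ x M Z = x * (x + + 1) * (x + + 2) * (+ 4 * (M - Z) + + 3 * x + + 1)

  twos₂-closed : ∀ M Z → Z ≤ M → + 24 * + ∑< Z (λ u → suc (M ℕ.∸ Z ℕ.+ u) ℕ.* triangle u) ≡ P-twos₂ (+ Z) (+ M) (+ Z)
  twos₂-closed M Z Z≤M = telescope (+ 24) (λ u → suc (M ℕ.∸ Z ℕ.+ u) ℕ.* triangle u) (λ x → P-twos₂ x (+ M) (+ Z)) Z refl step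
    where
    identity : ∀ x M Z →
      x * (x + + 1) * (x + + 2) * (+ 4 * (M - Z) + + 3 * x + + 1) + + 12 * (M - Z + x + + 1) * ((x + + 1) * (x + + 2))
      ≡ (x + + 1) * ((x + + 1) + + 1) * ((x + + 1) + + 2) * (+ 4 * (M - Z) + + 3 * (x + + 1) + + 1)
    identity = solve-∀
    regroup : ∀ a t → + 24 * (a * t) ≡ + 12 * a * (+ 2 * t)
    regroup = solve-∀
    step : ∀ u → u < Z → P-twos₂ (+ u) (+ M) (+ Z) + + 24 * + (suc (M ℕ.∸ Z ℕ.+ u) ℕ.* triangle u) ≡ P-twos₂ (+ u + + 1) (+ M) (+ Z)
    step u _ = begin
      P-twos₂ (+ u) (+ M) (+ Z) + + 24 * + (suc (M ℕ.∸ Z ℕ.+ u) ℕ.* triangle u)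
        ≡⟨ cong (λ t → P-twos₂ (+ u) (+ M) (+ Z) + t)
             (trans (cong (+ 24 *_) (ℤ.pos-* (suc (M ℕ.∸ Z ℕ.+ u)) (triangle u))) (regroup (+ suc (M ℕ.∸ Z ℕ.+ u)) (+ triangle u))) ⟩
      P-twos₂ (+ u) (+ M) (+ Z) + + 12 * + suc (M ℕ.∸ Z ℕ.+ u) * (+ 2 * + triangle u)
        ≡⟨ cong₂ (λ a t → P-twos₂ (+ u) (+ M) (+ Z) + + 12 * a * t)
             (trans (pos-suc (M ℕ.∸ Z ℕ.+ u)) (cong (_+ + 1) (trans (ℤ.pos-+ (M ℕ.∸ Z) u) (cong (_+ + u) (pos-∸ Z≤M)))))
             (triangle-closed u) ⟩
      P-twos₂ (+ u) (+ M) (+ Z) + + 12 * (+ M - + Z + + u + + 1) * ((+ u + + 1) * (+ u + + 2))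
        ≡⟨ identity (+ u) (+ M) (+ Z) ⟩
      P-twos₂ (+ u + + 1) (+ M) (+ Z) ∎
      where open ≡-Reasoning

  P-twos : ℤ → ℤ → ℤ
  P-twos x M = x * (x - + 1) * (x + + 1) * (+ 12 * M * (+ 2 * x + + 1) * (x + + 2) - (x - + 2) * (x + + 2) * (+ 5 * x + + 3))

  twos-closed : ∀ m → + 720 * + twos m ≡ P-twos (+ suc m) (+ suc m)
  twos-closed m = telescope (+ 720) (λ Z → suc Z ℕ.* ∑< Z (λ u → suc (M ℕ.∸ Z ℕ.+ u) ℕ.* triangle u))
    (λ x → P-twos x (+ M)) M refl step
    where
    M = suc m
    identity : ∀ x M →
      x * (x - + 1) * (x + + 1) * (+ 12 * M * (+ 2 * x + + 1) * (x + + 2) - (x - + 2) * (x + + 2) * (+ 5 * x + + 3))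
        + + 30 * (x + + 1) * (x * (x + + 1) * (x + + 2) * (+ 4 * (M - x) + + 3 * x + + 1))
      ≡ (x + + 1) * ((x + + 1) - + 1) * ((x + + 1) + + 1)
          * (+ 12 * M * (+ 2 * (x + + 1) + + 1) * ((x + + 1) + + 2) - ((x + + 1) - + 2) * ((x + + 1) + + 2) * (+ 5 * (x + + 1) + + 3))
    identity = solve-∀
    regroup : ∀ a k → + 720 * (a * k) ≡ + 30 * a * (+ 24 * k)
    regroup = solve-∀
    step : ∀ Z → Z < M → P-twos (+ Z) (+ M) + + 720 * + (suc Z ℕ.* ∑< Z (λ u → suc (M ℕ.∸ Z ℕ.+ u) ℕ.* triangle u))
                       ≡ P-twos (+ Z + + 1) (+ M)
    step Z Z<M = begin
      P-twos (+ Z) (+ M) + + 720 * + (suc Z ℕ.* K)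
        ≡⟨ cong (λ t → P-twos (+ Z) (+ M) + t) (trans (cong (+ 720 *_) (ℤ.pos-* (suc Z) K)) (regroup (+ suc Z) (+ K))) ⟩
      P-twos (+ Z) (+ M) + + 30 * + suc Z * (+ 24 * + K)
        ≡⟨ cong₂ (λ a k → P-twos (+ Z) (+ M) + + 30 * a * k) (pos-suc Z) (twos₂-closed M Z (ℕ.<⇒≤ Z<M)) ⟩
      P-twos (+ Z) (+ M) + + 30 * (+ Z + + 1) * P-twos₂ (+ Z) (+ M) (+ Z)
        ≡⟨ identity (+ Z) (+ M) ⟩
      P-twos (+ Z + + 1) (+ M) ∎
      where
      open ≡-Reasoning
      K = ∑< Z (λ u → suc (M ℕ.∸ Z ℕ.+ u) ℕ.* triangle u)

  P-classes : ℤ → ℤ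
  P-classes x = + 3 * x * (x + + 1) * (x + + 2) * (+ 33 * x * x * x + + 32 * x * x - + 17 * x - + 8)

  count-closed : ∀ m → + 720 * + count m ≡ P-classes (+ suc m)
  count-closed m = begin
    + 720 * + (T ℕ.+ (F ℕ.+ (F ℕ.+ W)))
      ≡⟨ cong (+ 720 *_) (trans (ℤ.pos-+ T _) (cong (λ n → + T + n) (trans (ℤ.pos-+ F _) (cong (λ n → + F + n) (ℤ.pos-+ F W))))) ⟩
    + 720 * (+ T + (+ F + (+ F + + W)))
      ≡⟨ regroup (+ T) (+ F) (+ W) ⟩
    + 30 * (+ 24 * + T) + + 2 * (+ 720 * + F) + + 720 * + W
      ≡⟨ cong₂ _+_ (cong₂ (λ t f → + 30 * t + + 2 * f) (tripods-closed m) (forks-closed m)) (twos-closed m) ⟩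
    + 30 * P-tripods x + + 2 * P-forks x x + P-twos x x
      ≡⟨ identity x ⟩
    P-classes x ∎
    where
    open ≡-Reasoning
    T = tripods m
    F = forks m
    W = twos m
    x = + suc m
    regroup : ∀ t f w → + 720 * (t + (f + (f + w))) ≡ + 30 * (+ 24 * t) + + 2 * (+ 720 * f) + + 720 * w
    regroup = solve-∀
    identity : ∀ x →
      let O : ℤ → ℤ
          O x = x * (x + + 1) * (x + + 2) * (+ 3 * x + + 1)
          F : ℤ → ℤ
          F x = x * (+ 15 * x * (x + + 1) * (x - + 1) * (x + + 1) * (+ 3 * x + + 10)
                     - (x - + 1) * (x + + 1) * (x - + 2) * (+ 5 * x * x + + 37 * x + + 24))
          W : ℤ → ℤ
          W x = x * (x - + 1) * (x + + 1) * (+ 12 * x * (+ 2 * x + + 1) * (x + + 2) - (x - + 2) * (x + + 2) * (+ 5 * x + + 3))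
      in + 30 * O x + + 2 * F x + W x ≡ + 3 * x * (x + + 1) * (x + + 2) * (+ 33 * x * x * x + + 32 * x * x - + 17 * x - + 8)
    identity = solve-∀

  sumTo-scale : ∀ c n f → c * sumTo n f ≡ sumTo n (λ i → c * f i)
  sumTo-scale c zero f = refl
  sumTo-scale c (suc n) f = trans (ℤ.*-distribˡ-+ c (sumTo n f) (f (suc n))) (cong (_+ c * f (suc n)) (sumTo-scale c n f))

  sumTo-cong : ∀ n {f g : ℕ → ℤ} → (∀ i → i ≤ n → f i ≡ g i) → sumTo n f ≡ sumTo n g
  sumTo-cong zero f≗g = f≗g 0 z≤n
  sumTo-cong (suc n) f≗g = cong₂ _+_ (sumTo-cong n (λ i i≤n → f≗g i (ℕ.m≤n⇒m≤1+n i≤n))) (f≗g (suc n) ℕ.≤-refl)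

  term-in-range : ∀ a m i → i ≤ m → term a m i ≡ sign i * + (7 C i) * + a (m ℕ.∸ i)
  term-in-range a m i i≤m rewrite Equivalence.to T-≡ (ℕ.≤⇒≤ᵇ i≤m) = refl

  seventh-difference : ∀ y → sumTo 7 (λ i → sign i * + (7 C i) * P-classes (y + + suc (7 ℕ.∸ i))) ≡ + 0
  seventh-difference = identity
    where
    identity : ∀ y →
      let P : ℤ → ℤ
          P x = + 3 * x * (x + + 1) * (x + + 2) * (+ 33 * x * x * x + + 32 * x * x - + 17 * x - + 8)
      in + 1 * + 1 * P (y + + 8) + - + 1 * + 7 * P (y + + 7) + + 1 * + 21 * P (y + + 6) + - + 1 * + 35 * P (y + + 5)
         + + 1 * + 35 * P (y + + 4) + - + 1 * + 21 * P (y + + 3) + + 1 * + 7 * P (y + + 2) + - + 1 * + 1 * P (y + + 1) ≡ + 0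
    identity = solve-∀

  generating-function : ∀ m → timesOneMinusX⁷ count m ≡ numerator m
  generating-function 0 = refl
  generating-function 1 = refl
  generating-function 2 = refl
  generating-function 3 = refl
  generating-function 4 = refl
  generating-function 5 = refl
  generating-function 6 = refl
  generating-function (suc (suc (suc (suc (suc (suc (suc k))))))) = ℤ.*-cancelˡ-≡ (+ 720) _ (+ 0) (begin
    + 720 * sumTo 7 (term count (7 ℕ.+ k))
      ≡⟨ sumTo-scale (+ 720) 7 (term count (7 ℕ.+ k)) ⟩
    sumTo 7 (λ i → + 720 * term count (7 ℕ.+ k) i)
      ≡⟨ sumTo-cong 7 scaled-term ⟩
    sumTo 7 (λ i → sign i * + (7 C i) * P-classes (+ k + + suc (7 ℕ.∸ i)))
      ≡⟨ seventh-difference (+ k) ⟩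
    + 0
      ≡⟨ ℤ.*-zeroʳ (+ 720) ⟨
    + 720 * + 0 ∎)
    where
    open ≡-Reasoning
    swap : ∀ c s b x → c * (s * b * x) ≡ s * b * (c * x)
    swap = solve-∀
    shift : ∀ i → i ≤ 7 → + suc (7 ℕ.+ k ℕ.∸ i) ≡ + k + + suc (7 ℕ.∸ i)
    shift i i≤7 = trans (cong (λ n → + suc n) (ℕ.+-∸-comm k i≤7)) (trans (ℤ.pos-+ (suc (7 ℕ.∸ i)) k) (ℤ.+-comm (+ suc (7 ℕ.∸ i)) (+ k)))
    scaled-term : ∀ i → i ≤ 7 → + 720 * term count (7 ℕ.+ k) i ≡ sign i * + (7 C i) * P-classes (+ k + + suc (7 ℕ.∸ i))
    scaled-term i i≤7 = begin
      + 720 * term count (7 ℕ.+ k) i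
        ≡⟨ cong (+ 720 *_) (term-in-range count (7 ℕ.+ k) i (ℕ.≤-trans i≤7 (ℕ.m≤m+n 7 k))) ⟩
      + 720 * (sign i * + (7 C i) * + count (7 ℕ.+ k ℕ.∸ i))
        ≡⟨ swap (+ 720) (sign i) (+ (7 C i)) (+ count (7 ℕ.+ k ℕ.∸ i)) ⟩
      sign i * + (7 C i) * (+ 720 * + count (7 ℕ.+ k ℕ.∸ i))
        ≡⟨ cong (sign i * + (7 C i) *_) (trans (count-closed (7 ℕ.+ k ℕ.∸ i)) (cong P-classes (shift i i≤7))) ⟩
      sign i * + (7 C i) * P-classes (+ k + + suc (7 ℕ.∸ i)) ∎

open Counting

module Classes where
  open import Data.Nat using (ℕ; zero; suc; _+_; _*_)
  import Data.Nat.Properties as ℕ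
  open import Data.Integer as ℤ using (ℤ; +_)
  import Data.Integer.Properties as ℤ
  open import Data.Integer.Tactic.RingSolver using (solve-∀)
  open import Data.Product using (Σ; ∃; _×_; _,_; proj₁; proj₂)
  open import Function using (Equivalence)
  open import Relation.Binary.PropositionalEquality

  nf-amplitreeNF : ∀ {m T} → Amplitree 3 (suc m) T → AmplitreeNF m (nf T)
  nf-amplitreeNF {m} {T} (wf , _ , type≡ , total≡ , balanced) = record
    { normal = nf-normal T
    ; wf = preserved* WF-move path wf
    ; defect≡ = trans (sym (invariant* defect defect-move path)) defect≡
    ; nBd≡ = trans (sym (invariant* nBd nBd-move path)) nBd≡
    ; balanced = preserved* (Every-move (EdgeBalanced-invariant (suc m))) path (Balanced⇒Every (suc m) T balanced)
    }
    where
    path = ⇒*nf T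
    defect≡ : defect T ≡ + 2
    defect≡ = trans (add-sub (defect T)) (cong (ℤ._- + 1) type≡)
      where
      add-sub : ∀ x → x ≡ (+ 1 ℤ.+ x) ℤ.- + 1
      add-sub = solve-∀
    nBd≡ : nBd T ≡ 3 * suc m
    nBd≡ = ℕ.suc-injective (trans total≡ (ℕ.+-comm (3 * suc m) 1))

  bipartize-amplitree : ∀ {m N} → AmplitreeNF m N → Amplitree 3 (suc m) (bipartize black N)
  bipartize-amplitree {m} {N} nf = WF-bipartize black N wf , bipartize-bipartite black N , cong (λ d → + 1 ℤ.+ d) defect′ , total′ ,
    Every⇒Balanced (suc m) (bipartize black N) total′ defect′ (Every-bipartize (EdgeBalanced-invariant (suc m)) black N balanced)
    where
    open AmplitreeNF nf
    defect′ : defect (bipartize black N) ≡ + 2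
    defect′ = trans (defect-bipartize black N) defect≡
    total′ : nTotal (bipartize black N) ≡ 3 * suc m + 1
    total′ = trans (cong suc (trans (nBd-bipartize black N) nBd≡)) (ℕ.+-comm 1 (3 * suc m))

  nf-bipartize-normal : ∀ {N} → Normal N → nf (bipartize black N) ≡ N
  nf-bipartize-normal {N} n = trans (nf-bipartize black N) (nf-of-normal n)

  classes : ∀ {m n} → Enumeration (AmplitreeNF m) n → NumClasses (Amplitree 3 (suc m)) n
  classes {m} E = record
    { reps = λ i → bipartize black (elem i)
    ; repsIn = λ i → bipartize-amplitree (sound i)
    ; distinct = λ i j reps≈ → injective (trans (sym (nf-rep i)) (trans (≈ₘ⇒nf≡ reps≈) (nf-rep j)))
    ; cover = λ T amplitree → let (i , elem≡) = complete (nf-amplitreeNF amplitree) in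
        i , nf≡⇒≈ₘ (trans (sym elem≡) (sym (nf-rep i)))
    }
    where
    open Enumeration E
    nf-rep : ∀ i → nf (bipartize black (elem i)) ≡ elem i
    nf-rep i = nf-bipartize-normal (AmplitreeNF.normal (sound i))

  normalForms : ∀ m → Enumeration (AmplitreeNF m) (count m)
  normalForms m = image shape (λ c v → Equivalence.from (valid⇔ c) v) (λ _ _ → shape-injective) onto (validCodes m)
    where
    onto : ∀ N → AmplitreeNF m N → ∃ λ c → Valid m c × shape c ≡ N
    onto N nf = let (c , N≡) = classify normal wf (ℤ.+-injective (trans (sym (defect-WF N wf)) defect≡))
                in c , Equivalence.to (valid⇔ c) (subst (AmplitreeNF m) N≡ nf) , sym N≡
      where open AmplitreeNF nf

open Classes

theorem7p25 : Σ (ℕ → ℕ) λ c →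
    ((m : ℕ) → NumClasses (Amplitree 3 (suc m)) (c m))
    × ((m : ℕ) → timesOneMinusX⁷ c m ≡ numerator m)
theorem7p25 = count , (λ m → classes (normalForms m)) , generating-function
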